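{- Let $c$ be a positive integer and $n\ge 1$. Then $$f(n)=\begin{cases} n!, & \text{if } n<c+1,\\ \sum_{j=1}^{n} g(0,1,j)\cdot g(1,0,n-j+1)\cdot\binom{n-1}{j-1}, & \text{if } n\ge c+1.\end{cases}$$
   Context: Permutations are written in one-line notation. The equivalence on $S_N$ is the equivalence relation generated by declaring $\phi\equiv\psi$ whenever $\phi=aub$, $\psi=avb$ for words $a,b$ and contiguous factors $u,v$ of length $c+1$ whose order permutations (the permutations of $\{1,\ldots,c+1\}$ with the same relative order) either both begin with $1$ or both end with $1$. $f(n)$ is the number of equivalence classes of $S_n$. For a positive integer $N$, $g(0,1,N)$ is the number of equivalence classes of $S_N$ containing at least one permutation whose last letter is $1$, and $g(1,0,N)$ is the number of equivalence classes of $S_N$ containing at least one permutation whose first letter is $1$. -}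

module Defs where

open import Data.Nat using (ℕ; zero; suc; _+_; _*_; _∸_; _<_; _≤_; _<?_)
open import Data.Nat.Combinatorics using (_C_)
open import Data.Nat.Base using (_!)
open import Data.List using (List; []; _∷_; _++_; length; map; filter; upTo; head; last)
open import Data.Nat.ListAction using (sum)
open import Data.List.Relation.Binary.Permutation.Propositional using (_↭_)
open import Data.List.Relation.Unary.Unique.Propositional using (Unique)
open import Data.List.Membership.Propositional using (_∈_)
open import Data.Maybe using (Maybe; just)
open import Data.Product using (Σ; ∃; _×_; _,_)
open import Data.Sum using (_⊎_)
open import Function.Bundles using (_⇔_)
open import Relation.Binary.PropositionalEquality using (_≡_)
open import Relation.Binary.Construct.Closure.Equivalence using (EqClosure)

-- π is (the one-line notation of) a permutation in S_N, i.e. a rearrangement of 1,…,N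
IsPerm : ℕ → List ℕ → Set
IsPerm N π = π ↭ map suc (upTo N)

-- order permutation (standardization) of a word of distinct letters:
-- each letter x is replaced by 1 + #{letters of u smaller than x}
std : List ℕ → List ℕ
std u = map (λ x → suc (length (filter (_<? x) u))) u

BeginsWith1 : List ℕ → Set
BeginsWith1 w = head w ≡ just 1

EndsWith1 : List ℕ → Set
EndsWith1 w = last w ≡ just 1

data Move (c N : ℕ) : List ℕ → List ℕ → Set where
  move : (a u v b : List ℕ) →
         length u ≡ suc c → length v ≡ suc c →
         IsPerm N (a ++ u ++ b) → IsPerm N (a ++ v ++ b) →
         (BeginsWith1 (std u) × BeginsWith1 (std v)) ⊎ (EndsWith1 (std u) × EndsWith1 (std v)) →
         Move c N (a ++ u ++ b) (a ++ v ++ b)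

Equiv : ℕ → ℕ → List ℕ → List ℕ → Set
Equiv c N = EqClosure (Move c N)

-- h labels the equivalence classes of S_N bijectively by 0,…,k-1;
-- hence k is the number of equivalence classes of S_N
record IsClassCount (c N k : ℕ) (h : List ℕ → ℕ) : Set where
  field
    bounded  : ∀ π → IsPerm N π → h π < k
    onto     : ∀ i → i < k → ∃ λ π → IsPerm N π × h π ≡ i
    sound    : ∀ π σ → IsPerm N π → IsPerm N σ → Equiv c N π σ → h π ≡ h σ
    complete : ∀ π σ → IsPerm N π → IsPerm N σ → h π ≡ h σ → Equiv c N π σ

-- m is the number of equivalence classes (labels under h) of S_N containing
-- at least one permutation π with property P
ClassesWith : (List ℕ → Set) → ℕ → (List ℕ → ℕ) → ℕ → Set
ClassesWith P N h m =
  Σ (List ℕ) λ L → Unique L ×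
    (∀ i → (i ∈ L) ⇔ (∃ λ π → IsPerm N π × P π × h π ≡ i)) × length L ≡ m

sumFrom1 : ℕ → (ℕ → ℕ) → ℕ
sumFrom1 n F = sum (map (λ i → F (suc i)) (upTo n))

-- A permutation π of 1, …, n splits at its letter 1 as π = α 1 β. A move replaces a window whose order pattern
-- begins or ends with 1; so if the window contains the letter 1, it begins or ends with it, and every move acts
-- inside α 1 or inside 1 β. Hence the set of letters of α and the classes of the order patterns of α 1 (which
-- ends with 1) and of 1 β (which begins with 1) are invariants of the class of π. Conversely, a set of j - 1
-- letters from 2, …, n and two such patterns of lengths j and n - j + 1 glue back to a permutation, and moves of
-- the patterns lift to moves of the glued permutation. So the classes of S_n correspond to the triples formed by
-- one of the (n-1 choose j-1) letter sets, one of the g(0,1,j) classes of S_j and one of the g(1,0,n-j+1)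
-- classes of S_(n-j+1). When n < c + 1 no window fits, every class is a singleton, and f(n) = n!.

module Submission where

open import Defs
open import Data.Nat using (ℕ; zero; suc; _+_; _*_; _∸_; _<_; _≤_; _<?_; _≟_; z≤n; s≤s; _!)
open import Relation.Binary.PropositionalEquality
  using (_≡_; refl; sym; trans; cong; cong₂; subst; subst₂; setoid; module ≡-Reasoning)
open import Data.Empty using (⊥; ⊥-elim)
open import Data.List using (List; []; _∷_; _++_; [_]; length; map; filter; upTo; applyUpTo; concatMap; head; last; take; drop)
open import Data.List.Membership.Propositional using (_∈_; _∉_; find; lose)
open import Data.List.Membership.Propositional.Properties
  using (∈-++⁻; ∈-++⁺ˡ; ∈-++⁺ʳ; ∈-∃++; ∈-map⁺; ∈-map⁻; ∈-upTo⁺; ∈-upTo⁻; ∈-filter⁻; ∈-filter⁺)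
open import Data.List.Membership.Propositional.Properties.WithK using (unique∧set⇒bag)
open import Data.List.Properties
  using (length-++; length-map; length-upTo; length-filter; map-upTo; map-∘; map-id; map-cong; map-cong-local; map-++;
         filter-accept; filter-reject; filter-none; filter-notAll; partition-defn; ++-identityʳ; ++-assoc; last-map;
         take++drop≡id; ≡-dec)
open import Data.List.Relation.Binary.BagAndSetEquality using (∼bag⇒↭)
open import Data.List.Relation.Binary.Permutation.Propositional
  using (_↭_; ↭-refl; ↭-sym; ↭-trans; ↭-prep; ↭-swap; ↭-reflexive; ↭⇒↭ₛ; ↭ₛ⇒↭)
open import Data.List.Relation.Binary.Permutation.Propositional.Properties
  using (↭-length; ↭-empty-inv; ∈-resp-↭; shift; zoom; drop-∷; drop-mid; filter-↭; map⁺; ++⁺ʳ; ++⁺ˡ; ∷↭∷ʳ)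
import Data.List.Relation.Binary.Permutation.Propositional.Properties as ↭
open import Data.List.Relation.Binary.Permutation.Setoid (setoid ℕ) using () renaming (_↭_ to _↭ₛ_)
import Data.List.Relation.Binary.Permutation.Setoid.Properties as ↭ₛ
open import Data.List.Relation.Unary.All as All using (All; []; _∷_)
open import Data.List.Relation.Unary.AllPairs as AllPairs using (AllPairs; []; _∷_)
import Data.List.Relation.Unary.AllPairs.Properties as AllPairsₚ
open import Data.List.Relation.Unary.Any as Any using (Any; here; there; any?)
open import Data.List.Relation.Unary.Unique.Propositional using (Unique)
import Data.List.Relation.Unary.Unique.Propositional.Properties as Uniqueₚ
open import Data.Maybe using (just)
import Data.Maybe as Maybe
open import Data.Maybe.Properties using (just-injective)
import Data.Maybe.Properties as Maybeₚ
open import Data.Nat.Combinatorics using (_C_; nCk+nC[k+1]≡[n+1]C[k+1])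
open import Data.Nat.ListAction using (sum)
open import Data.Nat.Properties
  using (+-comm; +-identityʳ; +-suc; *-comm; m+n∸m≡n; n∸n≡0; m<m+n; m≤m+n; m≤n+m; suc-injective;
         ≤-refl; ≤-reflexive; ≤-trans; ≤-antisym; <-irrefl; <-asym; <-trans; <-≤-trans; <-cmp;
         <⇒≢; <⇒≤; <⇒≱; ≤∧≢⇒<; ≮⇒≥; m≤n⇒m≤1+n; m<n⇒m<1+n)
open import Data.List.Membership.DecPropositional _≟_ using (_∈?_)
open import Data.Product using (Σ; ∃; _×_; _,_; proj₁; proj₂)
open import Data.Sum using (_⊎_; inj₁; inj₂; [_,_]′)
open import Function.Bundles using (mk⇔; Equivalence)
open import Relation.Binary.Construct.Closure.ReflexiveTransitive using (ε; _◅_; _◅◅_)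
import Relation.Binary.Construct.Closure.Equivalence as EqClosure
open import Relation.Binary.Construct.Closure.Symmetric using (fwd; bwd)
open import Relation.Binary.Definitions using (tri<; tri≈; tri>)
open import Relation.Nullary using (¬_; Dec; yes; no)
open import Relation.Nullary.Decidable using (¬?; _×-dec_; _⊎-dec_)
open import Relation.Unary using (Pred; Decidable)
open import Relation.Unary.Properties using (∁?)

module _ {A B : Set} where

  ∈-concatMap⁻ : ∀ (f : A → List B) xs {y} → y ∈ concatMap f xs → ∃ λ x → x ∈ xs × y ∈ f x
  ∈-concatMap⁻ f (x ∷ xs) y∈ with ∈-++⁻ (f x) y∈
  ... | inj₁ y∈fx = x , here refl , y∈fx
  ... | inj₂ y∈rest with ∈-concatMap⁻ f xs y∈rest
  ...   | x' , x'∈xs , y∈fx' = x' , there x'∈xs , y∈fx'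

  ∈-concatMap⁺ : ∀ (f : A → List B) {xs x y} → x ∈ xs → y ∈ f x → y ∈ concatMap f xs
  ∈-concatMap⁺ f {x ∷ xs} (here refl) y∈ = ∈-++⁺ˡ y∈
  ∈-concatMap⁺ f {x ∷ xs} (there x∈) y∈ = ∈-++⁺ʳ (f x) (∈-concatMap⁺ f x∈ y∈)

  length-concatMap : ∀ (f : A → List B) xs → length (concatMap f xs) ≡ sum (map (λ x → length (f x)) xs)
  length-concatMap f [] = refl
  length-concatMap f (x ∷ xs) = trans (length-++ (f x)) (cong (length (f x) +_) (length-concatMap f xs))

  length-concatMap-const : ∀ (f : A → List B) xs m → (∀ x → x ∈ xs → length (f x) ≡ m) →
                           length (concatMap f xs) ≡ length xs * m
  length-concatMap-const f [] m h = refl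
  length-concatMap-const f (x ∷ xs) m h =
    trans (length-++ (f x)) (cong₂ _+_ (h x (here refl)) (length-concatMap-const f xs m (λ y y∈ → h y (there y∈))))

  Unique-map-injectiveOn : ∀ (f : A → B) xs → (∀ x y → x ∈ xs → y ∈ xs → f x ≡ f y → x ≡ y) →
                           Unique xs → Unique (map f xs)
  Unique-map-injectiveOn f [] inj u = []
  Unique-map-injectiveOn f (x ∷ xs) inj (x∉ ∷ u) =
    All.tabulate fx∉ ∷ Unique-map-injectiveOn f xs (λ a b a∈ b∈ → inj a b (there a∈) (there b∈)) u
    where
    fx∉ : ∀ {z} → z ∈ map f xs → ¬ f x ≡ z
    fx∉ z∈ e with ∈-map⁻ f z∈
    ... | y , y∈ , refl = All.lookup x∉ y∈ (inj x y (here refl) (there y∈) e)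

module _ {A C K : Set} where

  Unique-concatMap : ∀ (F : A → List C) (key : C → K) (k : A → K) (P : List A) →
    Unique (map k P) → (∀ a → a ∈ P → Unique (F a)) → (∀ a c → a ∈ P → c ∈ F a → key c ≡ k a) →
    Unique (concatMap F P)
  Unique-concatMap F key k [] _ _ _ = []
  Unique-concatMap F key k (a ∷ P) (ka∉ ∷ u) uF keyF = Uniqueₚ.++⁺ (uF a (here refl)) rest disjoint
    where
    rest : Unique (concatMap F P)
    rest = Unique-concatMap F key k P u (λ b b∈ → uF b (there b∈)) (λ b c b∈ c∈ → keyF b c (there b∈) c∈)
    disjoint : ∀ {v} → v ∈ F a × v ∈ concatMap F P → ⊥
    disjoint (v∈Fa , v∈rest) with ∈-concatMap⁻ F P v∈rest
    ... | b , b∈ , v∈Fb =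
      All.lookup ka∉ (∈-map⁺ k b∈) (trans (sym (keyF a _ (here refl) v∈Fa)) (keyF b _ (there b∈) v∈Fb))

module _ {A B : Set} where

  dependentProduct : List A → (A → List B) → List (A × B)
  dependentProduct xs G = concatMap (λ x → map (x ,_) (G x)) xs

  ∈-dependentProduct⁻ : ∀ xs (G : A → List B) {x y} → (x , y) ∈ dependentProduct xs G → x ∈ xs × y ∈ G x
  ∈-dependentProduct⁻ xs G xy∈ with ∈-concatMap⁻ (λ x → map (x ,_) (G x)) xs xy∈
  ... | x , x∈ , xy∈' with ∈-map⁻ (x ,_) xy∈'
  ...   | _ , y∈ , refl = x∈ , y∈

  ∈-dependentProduct⁺ : ∀ {xs} (G : A → List B) {x y} → x ∈ xs → y ∈ G x → (x , y) ∈ dependentProduct xs G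
  ∈-dependentProduct⁺ G x∈ y∈ = ∈-concatMap⁺ (λ x → map (x ,_) (G x)) x∈ (∈-map⁺ (_ ,_) y∈)

  Unique-dependentProduct : ∀ xs (G : A → List B) → Unique xs → (∀ x → x ∈ xs → Unique (G x)) →
                            Unique (dependentProduct xs G)
  Unique-dependentProduct xs G u uG =
    Unique-concatMap (λ x → map (x ,_) (G x)) proj₁ (λ x → x) xs
      (subst Unique (sym (map-id xs)) u)
      (λ x x∈ → Uniqueₚ.map⁺ (λ { refl → refl }) (uG x x∈))
      (λ x p _ p∈ → first-is p∈)
    where
    first-is : ∀ {x ys p} → p ∈ map (x ,_) ys → proj₁ p ≡ x
    first-is {x} p∈ with ∈-map⁻ (x ,_) p∈
    ... | _ , _ , refl = refl

  length-dependentProduct : ∀ xs (G : A → List B) → length (dependentProduct xs G) ≡ sum (map (λ x → length (G x)) xs)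
  length-dependentProduct xs G =
    trans (length-concatMap (λ x → map (x ,_) (G x)) xs) (cong sum (map-cong (λ x → length-map (x ,_) (G x)) xs))


  length-dependentProduct-const : ∀ xs (G : A → List B) m → (∀ x → x ∈ xs → length (G x) ≡ m) →
                                  length (dependentProduct xs G) ≡ length xs * m
  length-dependentProduct-const xs G m |G| =
    length-concatMap-const (λ x → map (x ,_) (G x)) xs m (λ x x∈ → trans (length-map (x ,_) (G x)) (|G| x x∈))

range : ℕ → ℕ → List ℕ
range a zero = []
range a (suc m) = a ∷ range (suc a) m

∈-range⁻ : ∀ {x} a m → x ∈ range a m → a ≤ x × x < a + m
∈-range⁻ a (suc m) (here refl) = ≤-refl , m<m+n a (s≤s z≤n)
∈-range⁻ a (suc m) (there x∈) with ∈-range⁻ (suc a) m x∈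
... | a<x , x<end = <⇒≤ a<x , subst (_<_ _) (sym (+-suc a m)) x<end

∈-range⁺ : ∀ {x} a m → a ≤ x → x < a + m → x ∈ range a m
∈-range⁺ a zero a≤x x<a+0 = ⊥-elim (<⇒≱ (subst (_ <_) (+-identityʳ a) x<a+0) a≤x)
∈-range⁺ {x} a (suc m) a≤x x<end with a ≟ x
... | yes refl = here refl
... | no a≢x = there (∈-range⁺ (suc a) m (≤∧≢⇒< a≤x a≢x) (subst (x <_) (+-suc a m) x<end))

length-range : ∀ a m → length (range a m) ≡ m
length-range a zero = refl
length-range a (suc m) = cong suc (length-range (suc a) m)

range-increasing : ∀ a m → AllPairs _<_ (range a m)
range-increasing a zero = []
range-increasing a (suc m) = All.tabulate (λ x∈ → proj₁ (∈-range⁻ (suc a) m x∈)) ∷ range-increasing (suc a) m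

increasing⇒Unique : ∀ {xs} → AllPairs _<_ xs → Unique xs
increasing⇒Unique = AllPairs.map <⇒≢

map-suc-upTo : ∀ n → map suc (upTo n) ≡ range 1 n
map-suc-upTo n = trans (map-upTo suc n) (applyUpTo-shift suc 1 n (λ i → refl))
  where
  applyUpTo-shift : ∀ (f : ℕ → ℕ) a m → (∀ i → f i ≡ a + i) → applyUpTo f m ≡ range a m
  applyUpTo-shift f a zero f≗ = refl
  applyUpTo-shift f a (suc m) f≗ =
    cong₂ _∷_ (trans (f≗ 0) (+-identityʳ a))
      (applyUpTo-shift (λ i → f (suc i)) (suc a) m (λ i → trans (f≗ (suc i)) (+-suc a i)))

Unique-resp-↭ : ∀ {xs ys : List ℕ} → xs ↭ ys → Unique xs → Unique ys
Unique-resp-↭ p = ↭ₛ.Unique-resp-↭ (setoid ℕ) (↭⇒↭ₛ p)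

Unique-sameElements⇒↭ : ∀ {xs ys : List ℕ} → Unique xs → Unique ys →
                         (∀ {x} → x ∈ xs → x ∈ ys) → (∀ {x} → x ∈ ys → x ∈ xs) → xs ↭ ys
Unique-sameElements⇒↭ u v to from = ∼bag⇒↭ (unique∧set⇒bag u v (mk⇔ to from))

Unique-++⁻ˡ : ∀ (xs : List ℕ) {ys} → Unique (xs ++ ys) → Unique xs
Unique-++⁻ˡ [] u = []
Unique-++⁻ˡ (x ∷ xs) (x∉ ∷ u) = All.tabulate (λ y∈ → All.lookup x∉ (∈-++⁺ˡ y∈)) ∷ Unique-++⁻ˡ xs u

Unique-++⁻ʳ : ∀ (xs : List ℕ) {ys} → Unique (xs ++ ys) → Unique ys
Unique-++⁻ʳ [] u = u
Unique-++⁻ʳ (x ∷ xs) (_ ∷ u) = Unique-++⁻ʳ xs u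

Unique-∷ʳ⇒∉ : ∀ (xs : List ℕ) {y} → Unique (xs ++ [ y ]) → y ∉ xs
Unique-∷ʳ⇒∉ (x ∷ xs) (x∉ ∷ _) (here refl) = All.lookup x∉ (∈-++⁺ʳ xs (here refl)) refl
Unique-∷ʳ⇒∉ (x ∷ xs) (_ ∷ u) (there y∈) = Unique-∷ʳ⇒∉ xs u y∈

∉-++ : ∀ {y : ℕ} xs {ys} → y ∉ xs → y ∉ ys → y ∉ xs ++ ys
∉-++ xs y∉xs y∉ys y∈ with ∈-++⁻ xs y∈
... | inj₁ y∈xs = y∉xs y∈xs
... | inj₂ y∈ys = y∉ys y∈ys

++-assoc₃ : ∀ (a w b t : List ℕ) → (a ++ w ++ b) ++ t ≡ a ++ w ++ b ++ t
++-assoc₃ a w b t = trans (++-assoc a (w ++ b) t) (cong (a ++_) (++-assoc w b t))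

++-∷ʳ-++ : ∀ (a w : List ℕ) x b → a ++ (w ++ [ x ]) ++ b ≡ (a ++ w) ++ x ∷ b
++-∷ʳ-++ a w x b = trans (cong (a ++_) (++-assoc w [ x ] b)) (sym (++-assoc a w (x ∷ b)))

⊆-Unique⇒↭++ : ∀ (ys zs : List ℕ) → Unique ys → (∀ {x} → x ∈ ys → x ∈ zs) → ∃ λ rest → zs ↭ ys ++ rest
⊆-Unique⇒↭++ [] zs u ys⊆zs = zs , ↭-refl
⊆-Unique⇒↭++ (y ∷ ys) zs (y∉ys ∷ u) ys⊆zs with ∈-∃++ (ys⊆zs (here refl))
... | a , b , refl with ⊆-Unique⇒↭++ ys (a ++ b) u ys⊆ab
  where
  ys⊆ab : ∀ {x} → x ∈ ys → x ∈ a ++ b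
  ys⊆ab x∈ with ∈-++⁻ a (ys⊆zs (there x∈))
  ... | inj₁ x∈a = ∈-++⁺ˡ x∈a
  ... | inj₂ (here refl) = ⊥-elim (All.lookup y∉ys x∈ refl)
  ... | inj₂ (there x∈b) = ∈-++⁺ʳ a x∈b
... | rest , p = rest , ↭-trans (shift y a b) (↭-prep y p)

⊆-Unique-length⇒↭ : ∀ (ys zs : List ℕ) → Unique ys → (∀ {x} → x ∈ ys → x ∈ zs) → length zs ≤ length ys → zs ↭ ys
⊆-Unique-length⇒↭ ys zs u ys⊆zs |zs|≤|ys| with ⊆-Unique⇒↭++ ys zs u ys⊆zs
... | [] , p = ↭-trans p (↭-reflexive (++-identityʳ ys))
... | r ∷ rs , p = ⊥-elim (<⇒≱ longer |zs|≤|ys|)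
  where
  longer : length ys < length zs
  longer = subst (length ys <_) (sym (trans (↭-length p) (trans (length-++ ys) (+-suc (length ys) (length rs)))))
             (s≤s (m≤m+n (length ys) (length rs)))

length-Unique-upTo : ∀ (xs : List ℕ) k → Unique xs → (∀ {x} → x ∈ xs → x < k) → (∀ {i} → i < k → i ∈ xs) →
                     length xs ≡ k
length-Unique-upTo xs k u bounded onto =
  trans (↭-length (Unique-sameElements⇒↭ u (Uniqueₚ.upTo⁺ k) (λ x∈ → ∈-upTo⁺ (bounded x∈)) (λ i∈ → onto (∈-upTo⁻ i∈))))
        (length-upTo k)

↭-cancelˡ : ∀ (a : List ℕ) {xs ys} → a ++ xs ↭ a ++ ys → xs ↭ ys
↭-cancelˡ [] p = p
↭-cancelˡ (z ∷ a) p = ↭-cancelˡ a (drop-∷ p)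

↭-cancelʳ : ∀ (b : List ℕ) {xs ys} → xs ++ b ↭ ys ++ b → xs ↭ ys
↭-cancelʳ b {xs} {ys} p = ↭-cancelˡ b (↭-trans (↭.++-comm b xs) (↭-trans p (↭.++-comm ys b)))

filter-cong-local : ∀ {p q} {P : Pred ℕ p} {Q : Pred ℕ q} (P? : Decidable P) (Q? : Decidable Q) xs →
                    (∀ {x} → x ∈ xs → (P x → Q x) × (Q x → P x)) → filter P? xs ≡ filter Q? xs
filter-cong-local P? Q? [] P⇔Q = refl
filter-cong-local {P = P} {Q = Q} P? Q? (x ∷ xs) P⇔Q = step (P? x) (Q? x)
  where
  ih = filter-cong-local P? Q? xs (λ x∈ → P⇔Q (there x∈))
  step : Dec (P x) → Dec (Q x) → filter P? (x ∷ xs) ≡ filter Q? (x ∷ xs)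
  step (yes px) (yes qx) = trans (filter-accept P? px) (trans (cong (x ∷_) ih) (sym (filter-accept Q? qx)))
  step (yes px) (no ¬qx) = ⊥-elim (¬qx (proj₁ (P⇔Q (here refl)) px))
  step (no ¬px) (yes qx) = ⊥-elim (¬px (proj₂ (P⇔Q (here refl)) qx))
  step (no ¬px) (no ¬qx) = trans (filter-reject P? ¬px) (trans ih (sym (filter-reject Q? ¬qx)))

filter-++-filter-∁-↭ : ∀ {p} {P : Pred ℕ p} (P? : Decidable P) xs → filter P? xs ++ filter (∁? P?) xs ↭ xs
filter-++-filter-∁-↭ P? xs =
  ↭-sym (↭ₛ⇒↭ (subst (λ parts → xs ↭ₛ proj₁ parts ++ proj₂ parts) (partition-defn P? xs) (↭ₛ.partition-↭ (setoid ℕ) P? xs)))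

countBelow : List ℕ → ℕ → ℕ
countBelow w x = length (filter (_<? x) w)

countBelow-↭ : ∀ {w w'} → w ↭ w' → ∀ x → countBelow w x ≡ countBelow w' x
countBelow-↭ p x = ↭-length (filter-↭ (_<? x) p)

countBelow-∷-< : ∀ {z x} w → z < x → countBelow (z ∷ w) x ≡ suc (countBelow w x)
countBelow-∷-< {x = x} w z<x = cong length (filter-accept (_<? x) {xs = w} z<x)

countBelow-∷-≮ : ∀ {z x} w → ¬ z < x → countBelow (z ∷ w) x ≡ countBelow w x
countBelow-∷-≮ {x = x} w z≮x = cong length (filter-reject (_<? x) {xs = w} z≮x)

countBelow-mono : ∀ w {x y} → x ≤ y → countBelow w x ≤ countBelow w y
countBelow-mono [] x≤y = z≤n
countBelow-mono (z ∷ w) {x} {y} x≤y with z <? x | z <? y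
... | yes z<x | yes z<y
  rewrite countBelow-∷-< w z<x | countBelow-∷-< w z<y = s≤s (countBelow-mono w x≤y)
... | yes z<x | no z≮y  = ⊥-elim (z≮y (<-≤-trans z<x x≤y))
... | no z≮x  | yes z<y
  rewrite countBelow-∷-≮ w z≮x | countBelow-∷-< w z<y = m≤n⇒m≤1+n (countBelow-mono w x≤y)
... | no z≮x  | no z≮y
  rewrite countBelow-∷-≮ w z≮x | countBelow-∷-≮ w z≮y = countBelow-mono w x≤y

countBelow-strict : ∀ w {x y} → x < y → x ∈ w → countBelow w x < countBelow w y
countBelow-strict (z ∷ w) {x} {y} x<y (here refl)
  rewrite countBelow-∷-≮ w (<-irrefl {z} refl) | countBelow-∷-< w x<y = s≤s (countBelow-mono w (<⇒≤ x<y))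
countBelow-strict (z ∷ w) {x} {y} x<y (there x∈) with z <? x | z <? y
... | yes z<x | yes z<y
  rewrite countBelow-∷-< w z<x | countBelow-∷-< w z<y = s≤s (countBelow-strict w x<y x∈)
... | yes z<x | no z≮y = ⊥-elim (z≮y (<-trans z<x x<y))
... | no z≮x  | yes z<y
  rewrite countBelow-∷-≮ w z≮x | countBelow-∷-< w z<y = m<n⇒m<1+n (countBelow-strict w x<y x∈)
... | no z≮x  | no z≮y
  rewrite countBelow-∷-≮ w z≮x | countBelow-∷-≮ w z≮y = countBelow-strict w x<y x∈

countBelow≡0⇒≮ : ∀ w {x y} → countBelow w x ≡ 0 → y ∈ w → ¬ y < x
countBelow≡0⇒≮ (z ∷ w) {x} eq y∈ y<x with z <? x
... | yes z<x with () ← trans (sym (countBelow-∷-< w z<x)) eq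
countBelow≡0⇒≮ (z ∷ w) eq (here refl) y<x | no z≮x = z≮x y<x
countBelow≡0⇒≮ (z ∷ w) eq (there y∈) y<x | no z≮x = countBelow≡0⇒≮ w (trans (sym (countBelow-∷-≮ w z≮x)) eq) y∈ y<x

countBelow-range : ∀ a m i → i ≤ m → countBelow (range a m) (a + i) ≡ i
countBelow-range a zero .zero z≤n = refl
countBelow-range a (suc m) zero i≤m =
  trans (countBelow-∷-≮ (range (suc a) m) (<-irrefl (sym (+-identityʳ a))))
        (cong length (filter-none (_<? a + 0) (All.tabulate above)))
  where
  above : ∀ {x} → x ∈ range (suc a) m → ¬ x < a + 0
  above x∈ x<a = <⇒≱ (subst (_ <_) (+-identityʳ a) x<a) (<⇒≤ (proj₁ (∈-range⁻ (suc a) m x∈)))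
countBelow-range a (suc m) (suc i) (s≤s i≤m) =
  trans (countBelow-∷-< (range (suc a) m) (m<m+n a (s≤s z≤n)))
        (cong suc (subst (λ b → countBelow (range (suc a) m) b ≡ i) (sym (+-suc a i)) (countBelow-range (suc a) m i i≤m)))

nth : List ℕ → ℕ → ℕ
nth [] i = 0
nth (x ∷ xs) zero = x
nth (x ∷ xs) (suc i) = nth xs i

nth-countBelow : ∀ {x} S → AllPairs _<_ S → x ∈ S → nth S (countBelow S x) ≡ x
nth-countBelow (s ∷ S) (s< ∷ _) (here refl) =
  cong (nth (s ∷ S)) (trans (countBelow-∷-≮ S (<-irrefl refl))
    (cong length (filter-none (_<? s) (All.map (λ s<y y<s → <-asym s<y y<s) s<))))
nth-countBelow {x} (s ∷ S) (s< ∷ inc) (there x∈) =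
  trans (cong (nth (s ∷ S)) (countBelow-∷-< S (All.lookup s< x∈))) (nth-countBelow S inc x∈)

nth-∈ : ∀ S i → i < length S → nth S i ∈ S
nth-∈ (s ∷ S) zero _ = here refl
nth-∈ (s ∷ S) (suc i) (s≤s i<) = there (nth-∈ S i i<)

nth-increasing : ∀ S → AllPairs _<_ S → ∀ {i j} → i < j → j < length S → nth S i < nth S j
nth-increasing (s ∷ S) (s< ∷ _) {zero} {suc j} _ (s≤s j<) = All.lookup s< (nth-∈ S j j<)
nth-increasing (s ∷ S) (_ ∷ inc) {suc i} {suc j} (s≤s i<j) (s≤s j<) = nth-increasing S inc i<j j<

map-nth-range : ∀ S a → map (λ i → nth S (i ∸ a)) (range a (length S)) ≡ S
map-nth-range [] a = refl
map-nth-range (s ∷ S) a =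
  cong₂ _∷_ (cong (nth (s ∷ S)) (n∸n≡0 a))
    (trans (map-cong-local (All.tabulate (λ i∈ → cong (nth (s ∷ S)) (∸-suc (proj₁ (∈-range⁻ (suc a) (length S) i∈))))))
           (map-nth-range S (suc a)))
  where
  ∸-suc : ∀ {a i} → suc a ≤ i → i ∸ a ≡ suc (i ∸ suc a)
  ∸-suc {zero} {suc i} _ = refl
  ∸-suc {suc a} {suc i} (s≤s a<i) = ∸-suc a<i

splitAt1 : List ℕ → List ℕ × List ℕ
splitAt1 [] = [] , []
splitAt1 (x ∷ xs) with x ≟ 1
... | yes _ = [] , xs
... | no _ = x ∷ proj₁ (splitAt1 xs) , proj₂ (splitAt1 xs)

before1 after1 : List ℕ → List ℕ
before1 π = proj₁ (splitAt1 π)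
after1 π = proj₂ (splitAt1 π)

splitAt1-++ : ∀ α β → 1 ∉ α → splitAt1 (α ++ 1 ∷ β) ≡ (α , β)
splitAt1-++ [] β _ = refl
splitAt1-++ (x ∷ α) β 1∉ with x ≟ 1
... | yes refl = ⊥-elim (1∉ (here refl))
... | no _ rewrite splitAt1-++ α β (λ 1∈ → 1∉ (there 1∈)) = refl

splitAt1-correct : ∀ π → 1 ∈ π → π ≡ before1 π ++ 1 ∷ after1 π × 1 ∉ before1 π
splitAt1-correct (x ∷ π) 1∈ with x ≟ 1
... | yes refl = refl , λ ()
splitAt1-correct (x ∷ π) (here refl) | no x≢1 = ⊥-elim (x≢1 refl)
splitAt1-correct (x ∷ π) (there 1∈) | no x≢1 with splitAt1-correct π 1∈
... | eq , 1∉ = cong (x ∷_) eq , λ { (here 1≡x) → x≢1 (sym 1≡x) ; (there 1∈') → 1∉ 1∈' }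

before1-after1-++ : ∀ α β → 1 ∉ α → before1 (α ++ 1 ∷ β) ≡ α × after1 (α ++ 1 ∷ β) ≡ β
before1-after1-++ α β 1∉ = cong proj₁ (splitAt1-++ α β 1∉) , cong proj₂ (splitAt1-++ α β 1∉)

++-1-injective : ∀ α α' β β' → 1 ∉ α → 1 ∉ α' → α ++ 1 ∷ β ≡ α' ++ 1 ∷ β' → α ≡ α' × β ≡ β'
++-1-injective α α' β β' 1∉α 1∉α' eq
  with trans (sym (splitAt1-++ α β 1∉α)) (trans (cong splitAt1 eq) (splitAt1-++ α' β' 1∉α'))
... | refl = refl , refl

last-∷ʳ : ∀ (xs : List ℕ) y → last (xs ++ [ y ]) ≡ just y
last-∷ʳ [] y = refl
last-∷ʳ (x ∷ []) y = refl
last-∷ʳ (x ∷ x' ∷ xs) y = last-∷ʳ (x' ∷ xs) y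

last≡just⇒∷ʳ : ∀ (xs : List ℕ) {y} → last xs ≡ just y → ∃ λ init → xs ≡ init ++ [ y ]
last≡just⇒∷ʳ (x ∷ []) refl = [] , refl
last≡just⇒∷ʳ (x ∷ x' ∷ xs) eq with last≡just⇒∷ʳ (x' ∷ xs) eq
... | init , eq' = x ∷ init , cong (x ∷_) eq'

picks : List ℕ → List (ℕ × List ℕ)
picks [] = []
picks (x ∷ xs) = (x , xs) ∷ map (λ p → proj₁ p , x ∷ proj₂ p) (picks xs)

picks-sound : ∀ xs {y rest} → (y , rest) ∈ picks xs → xs ↭ y ∷ rest
picks-sound (x ∷ xs) (here refl) = ↭-refl
picks-sound (x ∷ xs) (there p∈) with ∈-map⁻ (λ p → proj₁ p , x ∷ proj₂ p) p∈
... | (y , rest) , p∈' , refl = ↭-trans (↭-prep x (picks-sound xs p∈')) (↭-swap x y ↭-refl)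

picks-complete : ∀ xs {y} → y ∈ xs → ∃ λ rest → (y , rest) ∈ picks xs
picks-complete (x ∷ xs) (here refl) = xs , here refl
picks-complete (x ∷ xs) (there y∈) with picks-complete xs y∈
... | rest , p∈ = x ∷ rest , there (∈-map⁺ (λ p → proj₁ p , x ∷ proj₂ p) p∈)

map-proj₁-picks : ∀ xs → map proj₁ (picks xs) ≡ xs
map-proj₁-picks [] = refl
map-proj₁-picks (x ∷ xs) = cong (x ∷_) (trans (sym (map-∘ (picks xs))) (map-proj₁-picks xs))

permutationsOf : ℕ → List ℕ → List (List ℕ)
permutationsOf zero [] = [ [] ]
permutationsOf zero (_ ∷ _) = []
permutationsOf (suc k) xs = concatMap (λ p → map (proj₁ p ∷_) (permutationsOf k (proj₂ p))) (picks xs)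

permutationsOf-sound : ∀ k xs {π} → π ∈ permutationsOf k xs → π ↭ xs × length π ≡ k
permutationsOf-sound zero [] (here refl) = ↭-refl , refl
permutationsOf-sound (suc k) xs π∈
  with ∈-concatMap⁻ (λ p → map (proj₁ p ∷_) (permutationsOf k (proj₂ p))) (picks xs) π∈
... | (y , rest) , p∈ , π∈' with ∈-map⁻ (y ∷_) π∈'
...   | π' , π'∈ , refl with permutationsOf-sound k rest π'∈
...     | π'↭ , |π'| = ↭-trans (↭-prep y π'↭) (↭-sym (picks-sound xs p∈)) , cong suc |π'|

permutationsOf-complete : ∀ k xs {π} → π ↭ xs → length xs ≡ k → π ∈ permutationsOf k xs
permutationsOf-complete zero [] π↭ _ rewrite ↭-empty-inv π↭ = here refl
permutationsOf-complete (suc k) (x ∷ xs) {[]} π↭ _ with () ← ↭-empty-inv (↭-sym π↭)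
permutationsOf-complete (suc k) (x ∷ xs) {y ∷ π} π↭ |xs| with picks-complete (x ∷ xs) (∈-resp-↭ π↭ (here refl))
... | rest , p∈ =
  ∈-concatMap⁺ (λ p → map (proj₁ p ∷_) (permutationsOf k (proj₂ p))) p∈
    (∈-map⁺ (y ∷_) (permutationsOf-complete k rest (drop-∷ (↭-trans π↭ y∷rest))
       (suc-injective (trans (sym (↭-length y∷rest)) |xs|))))
  where y∷rest = picks-sound (x ∷ xs) p∈

length-permutationsOf : ∀ k xs → length xs ≡ k → length (permutationsOf k xs) ≡ k !
length-permutationsOf zero [] _ = refl
length-permutationsOf (suc k) xs |xs| =
  trans (length-concatMap-const (λ p → map (proj₁ p ∷_) (permutationsOf k (proj₂ p))) (picks xs) (k !) length-block)
        (cong (_* k !) (trans (trans (sym (length-map proj₁ (picks xs))) (cong length (map-proj₁-picks xs))) |xs|))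
  where
  length-block : ∀ p → p ∈ picks xs → length (map (proj₁ p ∷_) (permutationsOf k (proj₂ p))) ≡ k !
  length-block (y , rest) p∈ =
    trans (length-map (y ∷_) (permutationsOf k rest))
          (length-permutationsOf k rest (suc-injective (trans (sym (↭-length (picks-sound xs p∈))) |xs|)))

Unique-permutationsOf : ∀ k xs → Unique xs → Unique (permutationsOf k xs)
Unique-permutationsOf zero [] _ = [] ∷ []
Unique-permutationsOf zero (_ ∷ _) _ = []
Unique-permutationsOf (suc k) xs u =
  Unique-concatMap (λ p → map (proj₁ p ∷_) (permutationsOf k (proj₂ p))) head (λ p → just (proj₁ p)) (picks xs)
    (subst Unique (sym (map-∘ {g = just} {f = proj₁} (picks xs))) (Uniqueₚ.map⁺ (λ { refl → refl }) (subst Unique (sym (map-proj₁-picks xs)) u)))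
    (λ { (y , rest) p∈ → Uniqueₚ.map⁺ (λ { refl → refl }) (Unique-permutationsOf k rest (unique-rest (Unique-resp-↭ (picks-sound xs p∈) u))) })
    (λ { (y , rest) _ _ π∈ → head-is π∈ })
  where
  unique-rest : ∀ {y rest} → Unique (y ∷ rest) → Unique rest
  unique-rest (_ ∷ u) = u
  head-is : ∀ {y πs π} → π ∈ map (y ∷_) πs → head π ≡ just y
  head-is {y} π∈ with ∈-map⁻ (y ∷_) π∈
  ... | _ , _ , refl = refl

sublistsOfLength : List ℕ → ℕ → List (List ℕ)
sublistsOfLength xs zero = [ [] ]
sublistsOfLength [] (suc k) = []
sublistsOfLength (x ∷ xs) (suc k) = map (x ∷_) (sublistsOfLength xs k) ++ sublistsOfLength xs (suc k)

length-sublistsOfLength : ∀ xs k → length (sublistsOfLength xs k) ≡ length xs C k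
length-sublistsOfLength xs zero = refl
length-sublistsOfLength [] (suc k) = refl
length-sublistsOfLength (x ∷ xs) (suc k) =
  trans (length-++ (map (x ∷_) (sublistsOfLength xs k)))
    (trans (cong₂ _+_ (trans (length-map (x ∷_) (sublistsOfLength xs k)) (length-sublistsOfLength xs k))
                      (length-sublistsOfLength xs (suc k)))
           (nCk+nC[k+1]≡[n+1]C[k+1] (length xs) k))

sublistsOfLength-⊆ : ∀ xs k {T} → T ∈ sublistsOfLength xs k → ∀ {y} → y ∈ T → y ∈ xs
sublistsOfLength-⊆ xs zero (here refl) ()
sublistsOfLength-⊆ (x ∷ xs) (suc k) T∈ y∈ with ∈-++⁻ (map (x ∷_) (sublistsOfLength xs k)) T∈
... | inj₂ T∈' = there (sublistsOfLength-⊆ xs (suc k) T∈' y∈)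
... | inj₁ T∈' with ∈-map⁻ (x ∷_) T∈'
...   | T' , T'∈ , refl with y∈
...     | here refl = here refl
...     | there y∈' = there (sublistsOfLength-⊆ xs k T'∈ y∈')

Unique-sublistsOfLength : ∀ xs k → Unique xs → Unique (sublistsOfLength xs k)
Unique-sublistsOfLength xs zero _ = [] ∷ []
Unique-sublistsOfLength [] (suc k) _ = []
Unique-sublistsOfLength (x ∷ xs) (suc k) (x∉ ∷ u) =
  Uniqueₚ.++⁺ (Uniqueₚ.map⁺ (λ { refl → refl }) (Unique-sublistsOfLength xs k u)) (Unique-sublistsOfLength xs (suc k) u) disjoint
  where
  disjoint : ∀ {T} → T ∈ map (x ∷_) (sublistsOfLength xs k) × T ∈ sublistsOfLength xs (suc k) → ⊥
  disjoint (T∈ , T∈') with ∈-map⁻ (x ∷_) T∈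
  ... | _ , _ , refl = All.lookup x∉ (sublistsOfLength-⊆ xs (suc k) T∈' (here refl)) refl

sublistsOfLength-sound : ∀ xs k {T} → Unique xs → T ∈ sublistsOfLength xs k → filter (_∈? T) xs ≡ T × length T ≡ k
sublistsOfLength-sound xs zero _ (here refl) = filter-none (_∈? []) {xs = xs} (All.tabulate (λ _ ())) , refl
sublistsOfLength-sound (x ∷ xs) (suc k) {T} (x∉ ∷ u) T∈ with ∈-++⁻ (map (x ∷_) (sublistsOfLength xs k)) T∈
... | inj₂ T∈' =
  let filtered , |T| = sublistsOfLength-sound xs (suc k) u T∈'
  in trans (filter-reject (_∈? T) (λ x∈T → All.lookup x∉ (sublistsOfLength-⊆ xs (suc k) T∈' x∈T) refl)) filtered , |T|
... | inj₁ T∈' with ∈-map⁻ (x ∷_) T∈'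
...   | T' , T'∈ , refl =
  let filtered , |T'| = sublistsOfLength-sound xs k u T'∈
  in trans (filter-accept (_∈? x ∷ T') (here refl))
       (cong (x ∷_) (trans (filter-cong-local (_∈? x ∷ T') (_∈? T') xs drop-x) filtered)) ,
     cong suc |T'|
  where
  drop-x : ∀ {y} → y ∈ xs → (y ∈ x ∷ T' → y ∈ T') × (y ∈ T' → y ∈ x ∷ T')
  drop-x y∈xs = (λ { (here refl) → ⊥-elim (All.lookup x∉ y∈xs refl) ; (there y∈) → y∈ }) , there

filter∈sublistsOfLength : ∀ {p} {P : Pred ℕ p} (P? : Decidable P) xs → filter P? xs ∈ sublistsOfLength xs (length (filter P? xs))
filter∈sublistsOfLength P? [] = here refl
filter∈sublistsOfLength {P = P} P? (x ∷ xs) = step (P? x)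
  where
  skip-x : ∀ T → T ∈ sublistsOfLength xs (length T) → T ∈ sublistsOfLength (x ∷ xs) (length T)
  skip-x [] _ = here refl
  skip-x (y ∷ T) T∈ = ∈-++⁺ʳ (map (x ∷_) (sublistsOfLength xs (length T))) T∈
  step : Dec (P x) → filter P? (x ∷ xs) ∈ sublistsOfLength (x ∷ xs) (length (filter P? (x ∷ xs)))
  step (yes px) rewrite filter-accept P? {xs = xs} px = ∈-++⁺ˡ (∈-map⁺ (x ∷_) (filter∈sublistsOfLength P? xs))
  step (no ¬px) rewrite filter-reject P? {xs = xs} ¬px = skip-x (filter P? xs) (filter∈sublistsOfLength P? xs)

-- Reachability in a finite graph, decided by induction on the set of allowed intermediate vertices.
module Reachability {A : Set} (_≟_ : ∀ (x y : A) → Dec (x ≡ y))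
                    (Step : A → A → Set) (Step? : ∀ x y → Dec (Step x y)) where

  data Path (S : List A) : A → A → Set where
    stay : ∀ {x} → Path S x x
    step : ∀ {x y} → Step x y → Path S x y
    via  : ∀ {x y} v → v ∈ S → Path S x v → Path S v y → Path S x y

  Path-weaken : ∀ {v S x y} → Path S x y → Path (v ∷ S) x y
  Path-weaken stay = stay
  Path-weaken (step s) = step s
  Path-weaken (via w w∈ p q) = via w (there w∈) (Path-weaken p) (Path-weaken q)

  Path-split : ∀ {v S x y} → Path (v ∷ S) x y → Path S x y ⊎ (Path S x v × Path S v y)
  Path-split stay = inj₁ stay
  Path-split (step s) = inj₁ (step s)
  Path-split (via w (here refl) p q) = inj₂ (to-v (Path-split p) , from-v (Path-split q))
    where
    to-v : ∀ {S x v} → Path S x v ⊎ (Path S x v × Path S v v) → Path S x v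
    to-v (inj₁ p) = p
    to-v (inj₂ (p , _)) = p
    from-v : ∀ {S v y} → Path S v y ⊎ (Path S v v × Path S v y) → Path S v y
    from-v (inj₁ q) = q
    from-v (inj₂ (_ , q)) = q
  Path-split (via w (there w∈) p q) with Path-split p | Path-split q
  ... | inj₁ p'         | inj₁ q'         = inj₁ (via w w∈ p' q')
  ... | inj₁ p'         | inj₂ (q₁ , q₂)  = inj₂ (via w w∈ p' q₁ , q₂)
  ... | inj₂ (p₁ , p₂)  | inj₁ q'         = inj₂ (p₁ , via w w∈ p₂ q')
  ... | inj₂ (p₁ , _)   | inj₂ (_ , q₂)   = inj₂ (p₁ , q₂)

  Path[]⇒≡⊎Step : ∀ {x y} → Path [] x y → x ≡ y ⊎ Step x y
  Path[]⇒≡⊎Step stay = inj₁ refl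
  Path[]⇒≡⊎Step (step s) = inj₂ s

  path? : ∀ S x y → Dec (Path S x y)
  path? [] x y with x ≟ y | Step? x y
  ... | yes refl | _     = yes stay
  ... | no _     | yes s = yes (step s)
  ... | no x≢y   | no ¬s = no λ p → [ x≢y , ¬s ]′ (Path[]⇒≡⊎Step p)
  path? (v ∷ S) x y with path? S x y | path? S x v | path? S v y
  ... | yes p | _     | _     = yes (Path-weaken p)
  ... | no _  | yes p | yes q = yes (via v (here refl) (Path-weaken p) (Path-weaken q))
  ... | no ¬p | no ¬p₁ | _    = no λ r → avoid (Path-split r)
    where
    avoid : _ → ⊥
    avoid (inj₁ p) = ¬p p
    avoid (inj₂ (p₁ , _)) = ¬p₁ p₁
  ... | no ¬p | yes _ | no ¬q = no λ r → avoid (Path-split r)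
    where
    avoid : _ → ⊥
    avoid (inj₁ p) = ¬p p
    avoid (inj₂ (_ , q)) = ¬q q

  Path-sym : (∀ {x y} → Step x y → Step y x) → ∀ {S x y} → Path S x y → Path S y x
  Path-sym sym stay = stay
  Path-sym sym (step s) = step (sym s)
  Path-sym sym (via v v∈ p q) = via v v∈ (Path-sym sym q) (Path-sym sym p)

-- The classes of a decidable equivalence on the elements of X, numbered 0, 1, … by the position of their
-- representative.
module ClassLabelling {A : Set} (X : List A) (_~_ : A → A → Set) (_~?_ : ∀ x y → Dec (x ~ y))
                      (~-refl : ∀ x → x ~ x) (~-sym : ∀ {x y} → x ~ y → y ~ x)
                      (~-trans : ∀ {x y z} → y ∈ X → x ~ y → y ~ z → x ~ z) where

  representatives : List A → List A
  representatives [] = []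
  representatives (x ∷ xs) = x ∷ filter (λ y → ¬? (x ~? y)) (representatives xs)

  representatives-⊆ : ∀ xs {r} → r ∈ representatives xs → r ∈ xs
  representatives-⊆ (x ∷ xs) (here refl) = here refl
  representatives-⊆ (x ∷ xs) (there r∈) =
    there (representatives-⊆ xs (proj₁ (∈-filter⁻ (λ y → ¬? (x ~? y)) r∈)))

  representatives-unrelated : ∀ xs → AllPairs (λ a b → ¬ a ~ b) (representatives xs)
  representatives-unrelated [] = []
  representatives-unrelated (x ∷ xs) =
    All.tabulate (λ r∈ → proj₂ (∈-filter⁻ (λ y → ¬? (x ~? y)) {xs = representatives xs} r∈))
    ∷ AllPairsₚ.filter⁺ (λ y → ¬? (x ~? y)) (representatives-unrelated xs)

  representatives-cover : ∀ xs → (∀ {z} → z ∈ xs → z ∈ X) → ∀ {y} → y ∈ xs →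
                          ∃ λ r → r ∈ representatives xs × r ~ y
  representatives-cover (x ∷ xs) xs⊆X (here refl) = x , here refl , ~-refl x
  representatives-cover (x ∷ xs) xs⊆X (there y∈) with representatives-cover xs (λ z∈ → xs⊆X (there z∈)) y∈
  ... | r , r∈ , r~y with x ~? r
  ...   | yes x~r = x , here refl , ~-trans (xs⊆X (there (representatives-⊆ xs r∈))) x~r r~y
  ...   | no x≁r = r , there (∈-filter⁺ (λ y → ¬? (x ~? y)) r∈ x≁r) , r~y

  label : List A → A → ℕ
  label [] y = 0
  label (r ∷ rs) y with r ~? y
  ... | yes _ = 0
  ... | no _ = suc (label rs y)

  label-< : ∀ rs {y r} → r ∈ rs → r ~ y → label rs y < length rs
  label-< (r ∷ rs) {y} r∈ r~y with r ~? y
  ... | yes _ = s≤s z≤n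
  label-< (r ∷ rs) (here refl) r~y | no r≁y = ⊥-elim (r≁y r~y)
  label-< (r ∷ rs) (there r∈) r~y | no _ = s≤s (label-< rs r∈ r~y)

  label-here : ∀ r rs → label (r ∷ rs) r ≡ 0
  label-here r rs with r ~? r
  ... | yes _ = refl
  ... | no r≁r = ⊥-elim (r≁r (~-refl r))

  label-there : ∀ r rs {y} → ¬ r ~ y → label (r ∷ rs) y ≡ suc (label rs y)
  label-there r rs {y} r≁y with r ~? y
  ... | yes r~y = ⊥-elim (r≁y r~y)
  ... | no _ = refl

  label-onto : ∀ rs → AllPairs (λ a b → ¬ a ~ b) rs → ∀ i → i < length rs → ∃ λ r → r ∈ rs × label rs r ≡ i
  label-onto (r ∷ rs) _ zero _ = r , here refl , label-here r rs
  label-onto (r ∷ rs) (r≁ ∷ unrelated) (suc i) (s≤s i<) with label-onto rs unrelated i i<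
  ... | r' , r'∈ , eq = r' , there r'∈ , trans (label-there r rs (All.lookup r≁ r'∈)) (cong suc eq)

  label-cong : ∀ rs {y z} → (∀ {r} → r ∈ rs → (r ~ y → r ~ z) × (r ~ z → r ~ y)) → label rs y ≡ label rs z
  label-cong [] _ = refl
  label-cong (r ∷ rs) {y} {z} same with r ~? y | r ~? z
  ... | yes _    | yes _    = refl
  ... | yes r~y  | no r≁z   = ⊥-elim (r≁z (proj₁ (same (here refl)) r~y))
  ... | no r≁y   | yes r~z  = ⊥-elim (r≁y (proj₂ (same (here refl)) r~z))
  ... | no _     | no _     = cong suc (label-cong rs (λ r∈ → same (there r∈)))

  label-injective : ∀ rs {y z} → label rs y ≡ label rs z → (∃ λ r → r ∈ rs × r ~ y) → (∃ λ r → r ∈ rs × r ~ z) →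
                    ∃ λ r → r ∈ rs × r ~ y × r ~ z
  label-injective (r ∷ rs) {y} {z} eq hy hz with r ~? y | r ~? z
  ... | yes r~y | yes r~z = r , here refl , r~y , r~z
  label-injective (r ∷ rs) () _ _ | yes _ | no _
  label-injective (r ∷ rs) () _ _ | no _  | yes _
  label-injective (r ∷ rs) eq hy hz | no r≁y | no r≁z
    with label-injective rs (suc-injective eq) (skip-r hy r≁y) (skip-r hz r≁z)
    where
    skip-r : ∀ {w} → (∃ λ r' → r' ∈ r ∷ rs × r' ~ w) → ¬ r ~ w → ∃ λ r' → r' ∈ rs × r' ~ w
    skip-r (_ , here refl , r~w) r≁w = ⊥-elim (r≁w r~w)
    skip-r (r' , there r'∈ , r'~w) _ = r' , r'∈ , r'~w
  ... | r' , r'∈ , r'~y , r'~z = r' , there r'∈ , r'~y , r'~z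

-- Order patterns

-- std w ≡ map (rank w) w holds by definition.
rank : List ℕ → ℕ → ℕ
rank w x = suc (countBelow w x)

rank-↭ : ∀ {w w'} → w ↭ w' → ∀ x → rank w x ≡ rank w' x
rank-↭ p x = cong suc (countBelow-↭ p x)

StrictlyMonotoneOn : List ℕ → (ℕ → ℕ) → Set
StrictlyMonotoneOn z F = ∀ {x y} → x ∈ z → y ∈ z → x < y → F x < F y

rank-strictlyMonotone : ∀ w → StrictlyMonotoneOn w (rank w)
rank-strictlyMonotone w x∈ _ x<y = s≤s (countBelow-strict w x<y x∈)

strictlyMonotone⇒injective : ∀ {z F} → StrictlyMonotoneOn z F → ∀ {x y} → x ∈ z → y ∈ z → F x ≡ F y → x ≡ y
strictlyMonotone⇒injective mono {x} {y} x∈ y∈ eq with <-cmp x y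
... | tri< x<y _ _ = ⊥-elim (<-irrefl eq (mono x∈ y∈ x<y))
... | tri≈ _ x≡y _ = x≡y
... | tri> _ _ y<x = ⊥-elim (<-irrefl (sym eq) (mono y∈ x∈ y<x))

countBelow-map : ∀ {z F x} → StrictlyMonotoneOn z F → x ∈ z → ∀ u → (∀ {y} → y ∈ u → y ∈ z) →
                 countBelow (map F u) (F x) ≡ countBelow u x
countBelow-map mono x∈ [] u⊆z = refl
countBelow-map {z} {F} {x} mono x∈ (y ∷ u) u⊆z with F y <? F x | y <? x
... | yes Fy<Fx | yes y<x = trans (countBelow-∷-< (map F u) Fy<Fx) (trans (cong suc ih) (sym (countBelow-∷-< u y<x)))
  where ih = countBelow-map mono x∈ u (λ y∈ → u⊆z (there y∈))
... | no Fy≮Fx | no y≮x = trans (countBelow-∷-≮ (map F u) Fy≮Fx) (trans ih (sym (countBelow-∷-≮ u y≮x)))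
  where ih = countBelow-map mono x∈ u (λ y∈ → u⊆z (there y∈))
... | no Fy≮Fx | yes y<x = ⊥-elim (Fy≮Fx (mono (u⊆z (here refl)) x∈ y<x))
... | yes Fy<Fx | no y≮x with <-cmp x y
...   | tri< x<y _ _ = ⊥-elim (<-asym Fy<Fx (mono x∈ (u⊆z (here refl)) x<y))
...   | tri≈ _ refl _ = ⊥-elim (<-irrefl refl Fy<Fx)
...   | tri> _ _ y<x = ⊥-elim (y≮x y<x)

std-map : ∀ {z F} → StrictlyMonotoneOn z F → ∀ u → (∀ {y} → y ∈ u → y ∈ z) → std (map F u) ≡ std u
std-map {F = F} mono u u⊆z =
  trans (sym (map-∘ u)) (map-cong-local (All.tabulate (λ x∈ → cong suc (countBelow-map mono (u⊆z x∈) u u⊆z))))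

IsPerm-∈⇒∈range : ∀ {n π x} → IsPerm n π → x ∈ π → x ∈ range 1 n
IsPerm-∈⇒∈range {n} p x∈ = subst (_ ∈_) (map-suc-upTo n) (∈-resp-↭ p x∈)

std-IsPerm : ∀ w → Unique w → IsPerm (length w) (std w)
std-IsPerm w u = ↭-sym (⊆-Unique-length⇒↭ (std w) (map suc (upTo (length w))) unique-std std⊆ same-length)
  where
  unique-std : Unique (std w)
  unique-std = Unique-map-injectiveOn (rank w) w
                 (λ x y x∈ y∈ → strictlyMonotone⇒injective (rank-strictlyMonotone w) x∈ y∈) u
  std⊆ : ∀ {x} → x ∈ std w → x ∈ map suc (upTo (length w))
  std⊆ x∈ with ∈-map⁻ (rank w) x∈
  ... | y , y∈ , refl = subst (rank w y ∈_) (sym (map-suc-upTo (length w)))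
        (∈-range⁺ 1 (length w) (s≤s z≤n) (s≤s (filter-notAll (_<? y) w (Any.map (λ { refl → <-irrefl refl }) y∈))))
  same-length : length (map suc (upTo (length w))) ≤ length (std w)
  same-length = ≤-reflexive (trans (length-map suc (upTo (length w))) (trans (length-upTo (length w)) (sym (length-map (rank w) w))))

std-IsPerm≡id : ∀ n ρ → IsPerm n ρ → std ρ ≡ ρ
std-IsPerm≡id n ρ p = trans (map-cong-local (All.tabulate rank≡id)) (map-id ρ)
  where
  rank≡id : ∀ {x} → x ∈ ρ → rank ρ x ≡ x
  rank≡id {x} x∈ with ∈-range⁻ 1 n (IsPerm-∈⇒∈range p x∈)
  rank≡id {suc i} x∈ | _ , s≤s i<n =
    cong suc (trans (countBelow-↭ p (suc i)) (trans (cong (λ l → countBelow l (suc i)) (map-suc-upTo n))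
      (countBelow-range 1 n i (<⇒≤ i<n))))

AgreeAt1 : List ℕ → List ℕ → Set
AgreeAt1 s t = (BeginsWith1 s × BeginsWith1 t) ⊎ (EndsWith1 s × EndsWith1 t)

Compatible : List ℕ → List ℕ → Set
Compatible u v = AgreeAt1 (std u) (std v)

module _ (c : ℕ) where

  -- A move on arbitrary words, forgetting the ambient symmetric group.
  data LocalMove : List ℕ → List ℕ → Set where
    replace : ∀ a u v b → length u ≡ suc c → u ↭ v → Compatible u v → LocalMove (a ++ u ++ b) (a ++ v ++ b)

  replace≡ : ∀ a u v b {x y} → x ≡ a ++ u ++ b → y ≡ a ++ v ++ b →
             length u ≡ suc c → u ↭ v → Compatible u v → LocalMove x y
  replace≡ a u v b refl refl = replace a u v b

  LocalMove-↭ : ∀ {x y} → LocalMove x y → x ↭ y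
  LocalMove-↭ (replace a _ _ _ _ u↭v _) = zoom a u↭v

  LocalMove-++ˡ : ∀ p {x y} → LocalMove x y → LocalMove (p ++ x) (p ++ y)
  LocalMove-++ˡ p (replace a u v b |u| u↭v compat) =
    replace≡ (p ++ a) u v b (sym (++-assoc p a _)) (sym (++-assoc p a _)) |u| u↭v compat

  LocalMove-++ʳ : ∀ s {x y} → LocalMove x y → LocalMove (x ++ s) (y ++ s)
  LocalMove-++ʳ s (replace a u v b |u| u↭v compat) =
    replace≡ a u v (b ++ s) (++-assoc₃ a u b s) (++-assoc₃ a v b s) |u| u↭v compat

  Move⇒LocalMove : ∀ {N x y} → Move c N x y → LocalMove x y × IsPerm N x × IsPerm N y
  Move⇒LocalMove (move a u v b |u| _ px py compat) =
    replace a u v b |u| (↭-cancelʳ b (↭-cancelˡ a (↭-trans px (↭-sym py)))) compat , px , py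

  LocalMove⇒Move : ∀ {N x y} → LocalMove x y → IsPerm N x → Move c N x y
  LocalMove⇒Move (replace a u v b |u| u↭v compat) px =
    move a u v b |u| (trans (sym (↭-length u↭v)) |u|) px (↭-trans (zoom a (↭-sym u↭v)) px) compat

  -- Relabelling by a strictly monotone map preserves the order pattern of every window.
  LocalMove-map : ∀ F {x y} → StrictlyMonotoneOn x F → LocalMove x y → LocalMove (map F x) (map F y)
  LocalMove-map F mono (replace a u v b |u| u↭v compat) =
    replace≡ (map F a) (map F u) (map F v) (map F b) (map-++₃ u) (map-++₃ v)
      (trans (length-map F u) |u|) (map⁺ F u↭v)
      (subst₂ AgreeAt1 (sym (std-map mono u u⊆)) (sym (std-map mono v v⊆)) compat)
    where
    map-++₃ : ∀ w → map F (a ++ w ++ b) ≡ map F a ++ map F w ++ map F b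
    map-++₃ w = trans (map-++ F a _) (cong (map F a ++_) (map-++ F w b))
    u⊆ : ∀ {y} → y ∈ u → y ∈ a ++ u ++ b
    u⊆ y∈ = ∈-++⁺ʳ a (∈-++⁺ˡ y∈)
    v⊆ : ∀ {y} → y ∈ v → y ∈ a ++ u ++ b
    v⊆ y∈ = u⊆ (∈-resp-↭ (↭-sym u↭v) y∈)

  LocalMove-std : ∀ {w w'} → LocalMove w w' → LocalMove (std w) (std w')
  LocalMove-std {w} {w'} mv =
    subst (LocalMove (std w)) (map-cong-local (All.tabulate (λ {x} _ → rank-↭ (LocalMove-↭ mv) x)))
      (LocalMove-map (rank w) (rank-strictlyMonotone w) mv)

Positive : List ℕ → Set
Positive π = ∀ {x} → x ∈ π → 1 ≤ x

rank≡1⇒≡1 : ∀ u {x} → rank u x ≡ 1 → 1 ∈ u → 1 ≤ x → x ≡ 1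
rank≡1⇒≡1 u eq 1∈ 1≤x = ≤-antisym (≮⇒≥ (countBelow≡0⇒≮ u (suc-injective eq) 1∈)) 1≤x

rank-1 : ∀ w → Positive w → rank w 1 ≡ 1
rank-1 w pos = cong suc (cong length (filter-none (_<? 1) (All.tabulate (λ x∈ x<1 → <⇒≱ x<1 (pos x∈)))))

BeginsWith1-std⇒1∷ : ∀ u → 1 ∈ u → Positive u → BeginsWith1 (std u) → ∃ λ u' → u ≡ 1 ∷ u'
BeginsWith1-std⇒1∷ (x ∷ u') 1∈ pos eq rewrite rank≡1⇒≡1 (x ∷ u') (just-injective eq) 1∈ (pos (here refl)) = u' , refl

EndsWith1-std⇒∷ʳ1 : ∀ u → 1 ∈ u → Positive u → EndsWith1 (std u) → ∃ λ u' → u ≡ u' ++ [ 1 ]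
EndsWith1-std⇒∷ʳ1 u 1∈ pos eq with last u in last≡ | trans (sym eq) (last-map (rank u) u)
... | just x | rank≡ with last≡just⇒∷ʳ u last≡
...   | u' , refl = u' , cong (λ y → u' ++ [ y ]) (rank≡1⇒≡1 u (just-injective (sym rank≡)) 1∈ (pos (∈-++⁺ʳ u' (here refl))))

module _ (c : ℕ) where

  data MoveBeside1 (α β : List ℕ) : List ℕ → Set where
    left  : ∀ {α'} → 1 ∉ α' → LocalMove c (α ++ [ 1 ]) (α' ++ [ 1 ]) → MoveBeside1 α β (α' ++ 1 ∷ β)
    right : ∀ {β'} → LocalMove c (1 ∷ β) (1 ∷ β') → MoveBeside1 α β (α ++ 1 ∷ β')

  left≡ : ∀ {α β α' σ} → σ ≡ α' ++ 1 ∷ β → 1 ∉ α' → LocalMove c (α ++ [ 1 ]) (α' ++ [ 1 ]) → MoveBeside1 α β σ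
  left≡ refl = left

  right≡ : ∀ {α β β' σ} → σ ≡ α ++ 1 ∷ β' → LocalMove c (1 ∷ β) (1 ∷ β') → MoveBeside1 α β σ
  right≡ refl = right

  move-after-1 : ∀ α β a u v b → 1 ∉ α → 1 ∈ a → a ++ u ++ b ≡ α ++ 1 ∷ β →
                 length u ≡ suc c → u ↭ v → Compatible u v → MoveBeside1 α β (a ++ v ++ b)
  move-after-1 α β a u v b 1∉α 1∈a π≡ |u| u↭v compat with splitAt1-correct a 1∈a
  ... | a≡ , 1∉a₁ with ++-1-injective α (before1 a) β (after1 a ++ u ++ b) 1∉α 1∉a₁
                         (trans (sym π≡) (trans (cong (_++ u ++ b) a≡) (++-assoc (before1 a) _ (u ++ b))))
  ... | refl , refl =
    right≡ (trans (cong (_++ v ++ b) a≡) (++-assoc α _ (v ++ b))) (replace (1 ∷ after1 a) u v b |u| u↭v compat)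

  move-before-1 : ∀ α β a u v b → 1 ∉ α → 1 ∉ a → 1 ∉ u → 1 ∈ b → a ++ u ++ b ≡ α ++ 1 ∷ β →
                  length u ≡ suc c → u ↭ v → Compatible u v → MoveBeside1 α β (a ++ v ++ b)
  move-before-1 α β a u v b 1∉α 1∉a 1∉u 1∈b π≡ |u| u↭v compat with splitAt1-correct b 1∈b
  ... | b≡ , 1∉b₁ with ++-1-injective α (a ++ u ++ before1 b) β (after1 b) 1∉α (∉-++ a 1∉a (∉-++ u 1∉u 1∉b₁))
                         (trans (sym π≡) (trans (cong (λ z → a ++ u ++ z) b≡) (sym (++-assoc₃ a u (before1 b) (1 ∷ after1 b)))))
  ... | refl , refl =
    left≡ (trans (cong (λ z → a ++ v ++ z) b≡) (sym (++-assoc₃ a v (before1 b) (1 ∷ after1 b)))) (∉-++ a 1∉a (∉-++ v 1∉v 1∉b₁))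
      (replace≡ c a u v (before1 b ++ [ 1 ]) (++-assoc₃ a u (before1 b) [ 1 ]) (++-assoc₃ a v (before1 b) [ 1 ]) |u| u↭v compat)
    where
    1∉v : 1 ∉ v
    1∉v 1∈v = 1∉u (∈-resp-↭ (↭-sym u↭v) 1∈v)

  -- The window contains the first 1, and its order pattern starts or ends with 1, so the window itself starts or
  -- ends with 1.
  move-through-1 : ∀ α β a u v b → Unique u → Positive u → 1 ∉ α → 1 ∉ a → 1 ∈ u → a ++ u ++ b ≡ α ++ 1 ∷ β →
                   length u ≡ suc c → u ↭ v → Compatible u v → MoveBeside1 α β (a ++ v ++ b)
  move-through-1 α β a u v b _ pos 1∉α 1∉a 1∈u π≡ |u| u↭v compat@(inj₁ (u₁ , v₁))
    with BeginsWith1-std⇒1∷ u 1∈u pos u₁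
       | BeginsWith1-std⇒1∷ v (∈-resp-↭ u↭v 1∈u) (λ x∈ → pos (∈-resp-↭ (↭-sym u↭v) x∈)) v₁
  ... | u' , refl | v' , refl with ++-1-injective α a β (u' ++ b) 1∉α 1∉a (sym π≡)
  ...   | refl , refl = right (replace [] u v b |u| u↭v compat)
  move-through-1 α β a u v b un pos 1∉α 1∉a 1∈u π≡ |u| u↭v compat@(inj₂ (u₁ , v₁))
    with EndsWith1-std⇒∷ʳ1 u 1∈u pos u₁
       | EndsWith1-std⇒∷ʳ1 v (∈-resp-↭ u↭v 1∈u) (λ x∈ → pos (∈-resp-↭ (↭-sym u↭v) x∈)) v₁
  ... | u' , refl | v' , refl with Unique-∷ʳ⇒∉ u' un
  ...   | 1∉u' with ++-1-injective α (a ++ u') β b 1∉α (∉-++ a 1∉a 1∉u') (trans (sym π≡) (++-∷ʳ-++ a u' 1 b))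
  ...     | refl , refl =
    left≡ (++-∷ʳ-++ a v' 1 b) (∉-++ a 1∉a 1∉v') (replace≡ c a u v [] (window u') (window v') |u| u↭v compat)
    where
    window : ∀ w → (a ++ w) ++ [ 1 ] ≡ a ++ (w ++ [ 1 ]) ++ []
    window w = trans (++-assoc a w [ 1 ]) (cong (a ++_) (sym (++-identityʳ (w ++ [ 1 ]))))
    1∉v' : 1 ∉ v'
    1∉v' 1∈v' = 1∉u' (∈-resp-↭ (↭-cancelʳ [ 1 ] (↭-sym u↭v)) 1∈v')

  LocalMove⇒MoveBeside1 : ∀ {π σ} α β → Unique π → Positive π → π ≡ α ++ 1 ∷ β → 1 ∉ α →
                          LocalMove c π σ → MoveBeside1 α β σ
  LocalMove⇒MoveBeside1 α β un pos π≡ 1∉α (replace a u v b |u| u↭v compat) with 1 ∈? a | 1 ∈? u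
  ... | yes 1∈a | _ = move-after-1 α β a u v b 1∉α 1∈a π≡ |u| u↭v compat
  ... | no 1∉a | yes 1∈u =
    move-through-1 α β a u v b (Unique-++⁻ˡ u (Unique-++⁻ʳ a un)) (λ x∈ → pos (∈-++⁺ʳ a (∈-++⁺ˡ x∈)))
      1∉α 1∉a 1∈u π≡ |u| u↭v compat
  ... | no 1∉a | no 1∉u = move-before-1 α β a u v b 1∉α 1∉a 1∉u 1∈b π≡ |u| u↭v compat
    where
    1∈b : 1 ∈ b
    1∈b with ∈-++⁻ a (subst (1 ∈_) (sym π≡) (∈-++⁺ʳ α (here refl)))
    ... | inj₁ 1∈a = ⊥-elim (1∉a 1∈a)
    ... | inj₂ 1∈ub with ∈-++⁻ u 1∈ub
    ...   | inj₁ 1∈u = ⊥-elim (1∉u 1∈u)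
    ...   | inj₂ 1∈b = 1∈b

-- Deciding the equivalence

_≟ₗ_ : ∀ (x y : List ℕ) → Dec (x ≡ y)
_≟ₗ_ = ≡-dec _≟_

BeginsWith1? : ∀ w → Dec (BeginsWith1 w)
BeginsWith1? w = Maybeₚ.≡-dec _≟_ (head w) (just 1)

EndsWith1? : ∀ w → Dec (EndsWith1 w)
EndsWith1? w = Maybeₚ.≡-dec _≟_ (last w) (just 1)

Compatible? : ∀ u v → Dec (Compatible u v)
Compatible? u v = (BeginsWith1? (std u) ×-dec BeginsWith1? (std v)) ⊎-dec (EndsWith1? (std u) ×-dec EndsWith1? (std v))

take-++ : ∀ (u b : List ℕ) → take (length u) (u ++ b) ≡ u
take-++ [] b = refl
take-++ (x ∷ u) b = cong (x ∷_) (take-++ u b)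

drop-++ : ∀ (u b : List ℕ) → drop (length u) (u ++ b) ≡ b
drop-++ [] b = refl
drop-++ (x ∷ u) b = drop-++ u b

length-1…N : ∀ N → length (map suc (upTo N)) ≡ N
length-1…N N = trans (length-map suc (upTo N)) (length-upTo N)

permutations : ℕ → List (List ℕ)
permutations N = permutationsOf N (map suc (upTo N))

permutations-sound : ∀ N {π} → π ∈ permutations N → IsPerm N π
permutations-sound N π∈ = proj₁ (permutationsOf-sound N (map suc (upTo N)) π∈)

permutations-complete : ∀ N {π} → IsPerm N π → π ∈ permutations N
permutations-complete N p = permutationsOf-complete N _ p (length-1…N N)

Unique-1…N : ∀ N → Unique (map suc (upTo N))
Unique-1…N N = subst Unique (sym (map-suc-upTo N)) (increasing⇒Unique (range-increasing 1 N))

module _ (c : ℕ) where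

  frontMoves : List ℕ → List (List ℕ)
  frontMoves w = map (_++ drop (suc c) w) (filter (Compatible? window) (permutationsOf (suc c) window))
    where window = take (suc c) w

  neighbours : List ℕ → List (List ℕ)
  neighbours [] = []
  neighbours (x ∷ w) = frontMoves (x ∷ w) ++ map (x ∷_) (neighbours w)

  frontMoves-sound : ∀ w {z} → z ∈ frontMoves w → LocalMove c w z
  frontMoves-sound w z∈ with ∈-map⁻ (_++ drop (suc c) w) z∈
  ... | v , v∈ , refl with ∈-filter⁻ (Compatible? (take (suc c) w)) v∈
  ...   | v∈perms , compat with permutationsOf-sound (suc c) (take (suc c) w) v∈perms
  ...     | v↭ , |v| =
    replace≡ c [] (take (suc c) w) v (drop (suc c) w) (sym (take++drop≡id (suc c) w)) refl
      (trans (sym (↭-length v↭)) |v|) (↭-sym v↭) compat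

  frontMoves-complete : ∀ u v b → length u ≡ suc c → u ↭ v → Compatible u v → v ++ b ∈ frontMoves (u ++ b)
  frontMoves-complete u v b |u| u↭v compat =
    subst₂ (λ t d → v ++ b ∈ map (_++ d) (filter (Compatible? t) (permutationsOf (suc c) t)))
      (sym (subst (λ k → take k (u ++ b) ≡ u) |u| (take-++ u b))) (sym (subst (λ k → drop k (u ++ b) ≡ b) |u| (drop-++ u b)))
      (∈-map⁺ (_++ b) (∈-filter⁺ (Compatible? u) (permutationsOf-complete (suc c) u (↭-sym u↭v) |u|) compat))

  neighbours-sound : ∀ w {z} → z ∈ neighbours w → LocalMove c w z
  neighbours-sound (x ∷ w) z∈ with ∈-++⁻ (frontMoves (x ∷ w)) z∈
  ... | inj₁ z∈front = frontMoves-sound (x ∷ w) z∈front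
  ... | inj₂ z∈rest with ∈-map⁻ (x ∷_) z∈rest
  ...   | z' , z'∈ , refl = LocalMove-++ˡ c [ x ] (neighbours-sound w z'∈)

  neighbours-complete : ∀ {w z} → LocalMove c w z → z ∈ neighbours w
  neighbours-complete (replace [] (x ∷ u) v b |u| u↭v compat) = ∈-++⁺ˡ (frontMoves-complete (x ∷ u) v b |u| u↭v compat)
  neighbours-complete (replace (x ∷ a) u v b |u| u↭v compat) =
    ∈-++⁺ʳ (frontMoves (x ∷ a ++ u ++ b)) (∈-map⁺ (x ∷_) (neighbours-complete (replace a u v b |u| u↭v compat)))

  Adjacent : List ℕ → List ℕ → Set
  Adjacent x y = y ∈ neighbours x ⊎ x ∈ neighbours y

  Adjacent? : ∀ x y → Dec (Adjacent x y)
  Adjacent? x y = any? (y ≟ₗ_) (neighbours x) ⊎-dec any? (x ≟ₗ_) (neighbours y)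

  Adjacent-sym : ∀ {x y} → Adjacent x y → Adjacent y x
  Adjacent-sym (inj₁ y∈) = inj₂ y∈
  Adjacent-sym (inj₂ x∈) = inj₁ x∈

  open Reachability _≟ₗ_ Adjacent Adjacent?

  Equiv⇒Path : ∀ N {x y} → Equiv c N x y → Path (permutations N) x y
  Equiv⇒Path N ε = stay
  Equiv⇒Path N (fwd mv ◅ rest) with Move⇒LocalMove c mv
  ... | lmv , _ , pz = via _ (permutations-complete N pz) (step (inj₁ (neighbours-complete lmv))) (Equiv⇒Path N rest)
  Equiv⇒Path N (bwd mv ◅ rest) with Move⇒LocalMove c mv
  ... | lmv , pz , _ = via _ (permutations-complete N pz) (step (inj₂ (neighbours-complete lmv))) (Equiv⇒Path N rest)

  Path⇒Equiv : ∀ N {S x y} → Path S x y → (∀ {v} → v ∈ S → IsPerm N v) → IsPerm N x → IsPerm N y → Equiv c N x y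
  Path⇒Equiv N stay _ _ _ = ε
  Path⇒Equiv N (step (inj₁ y∈)) _ px _ = fwd (LocalMove⇒Move c (neighbours-sound _ y∈) px) ◅ ε
  Path⇒Equiv N (step (inj₂ x∈)) _ _ py = bwd (LocalMove⇒Move c (neighbours-sound _ x∈) py) ◅ ε
  Path⇒Equiv N (via v v∈ p q) S⊆ px py = Path⇒Equiv N p S⊆ px (S⊆ v∈) ◅◅ Path⇒Equiv N q S⊆ (S⊆ v∈) py

  classCount : ∀ N → Σ ℕ λ k → Σ (List ℕ → ℕ) λ h → IsClassCount c N k h
  classCount N = length reps , label reps , record
    { bounded = λ π p → bounded (permutations-complete N p)
    ; onto = λ i i< → let r , r∈ , eq = label-onto reps (representatives-unrelated X) i i<
                      in r , permutations-sound N (representatives-⊆ X r∈) , eq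
    ; sound = λ π σ pπ pσ eq → label-cong reps (λ r∈ → same-class (Equiv⇒Path N eq) (X∋ pπ) (X∋ pσ))
    ; complete = complete
    }
    where
    X : List (List ℕ)
    X = permutations N
    X∋ : ∀ {π} → IsPerm N π → π ∈ X
    X∋ = permutations-complete N
    open ClassLabelling X (Path X) (path? X) (λ _ → stay) (Path-sym Adjacent-sym) (λ y∈ p q → via _ y∈ p q)
    reps : List (List ℕ)
    reps = representatives X
    bounded : ∀ {π} → π ∈ X → label reps π < length reps
    bounded π∈ with representatives-cover X (λ z∈ → z∈) π∈
    ... | r , r∈ , r~π = label-< reps r∈ r~π
    same-class : ∀ {y z r} → Path X y z → y ∈ X → z ∈ X → (Path X r y → Path X r z) × (Path X r z → Path X r y)
    same-class y~z y∈ z∈ = (λ r~y → via _ y∈ r~y y~z) , (λ r~z → via _ z∈ r~z (Path-sym Adjacent-sym y~z))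
    complete : ∀ π σ → IsPerm N π → IsPerm N σ → label reps π ≡ label reps σ → Equiv c N π σ
    complete π σ pπ pσ eq with label-injective reps eq (representatives-cover X (λ z∈ → z∈) (X∋ pπ))
                                                       (representatives-cover X (λ z∈ → z∈) (X∋ pσ))
    ... | r , r∈ , r~π , r~σ =
      Path⇒Equiv N (via r (representatives-⊆ X r∈) (Path-sym Adjacent-sym r~π) r~σ) (permutations-sound N) pπ pσ

  classesWith : ∀ (P : List ℕ → Set) → (∀ π → Dec (P π)) → ∀ N k h → IsClassCount c N k h →
                ∃ λ m → ClassesWith P N h m
  classesWith P P? N k h cc = length L , L , Uniqueₚ.filter⁺ Hit? (Uniqueₚ.upTo⁺ k) , (λ i → mk⇔ (witness i) (hit i)) , refl
    where
    open IsClassCount cc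
    Hit : ℕ → Set
    Hit i = Any (λ π → P π × h π ≡ i) (permutations N)
    Hit? : ∀ i → Dec (Hit i)
    Hit? i = any? (λ π → P? π ×-dec (h π ≟ i)) (permutations N)
    L : List ℕ
    L = filter Hit? (upTo k)
    witness : ∀ i → i ∈ L → ∃ λ π → IsPerm N π × P π × h π ≡ i
    witness i i∈ with find (proj₂ (∈-filter⁻ Hit? {xs = upTo k} i∈))
    ... | π , π∈ , pπ , eq = π , permutations-sound N π∈ , pπ , eq
    hit : ∀ i → (∃ λ π → IsPerm N π × P π × h π ≡ i) → i ∈ L
    hit i (π , pπ , Pπ , eq) =
      ∈-filter⁺ Hit? (∈-upTo⁺ (subst (_< k) eq (bounded π pπ))) (lose (permutations-complete N pπ) (Pπ , eq))

-- The split at 1 is a class invariant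

IsPerm⇒Unique : ∀ {N π} → IsPerm N π → Unique π
IsPerm⇒Unique {N} p = Unique-resp-↭ (↭-sym p) (Unique-1…N N)

IsPerm⇒Positive : ∀ {N π} → IsPerm N π → Positive π
IsPerm⇒Positive {N} p x∈ = proj₁ (∈-range⁻ 1 N (IsPerm-∈⇒∈range p x∈))

IsPerm⇒1∈ : ∀ {N π} → IsPerm (suc N) π → 1 ∈ π
IsPerm⇒1∈ p = ∈-resp-↭ (↭-sym p) (here refl)

IsPerm⇒split : ∀ {N π} → IsPerm (suc N) π → π ≡ before1 π ++ 1 ∷ after1 π × 1 ∉ before1 π
IsPerm⇒split {π = π} p = splitAt1-correct π (IsPerm⇒1∈ p)

leftPart rightPart : List ℕ → List ℕ
leftPart π = std (before1 π ++ [ 1 ])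
rightPart π = std (1 ∷ after1 π)

module _ {N π} (p : IsPerm (suc N) π) where

  private
    π≡ : π ≡ before1 π ++ 1 ∷ after1 π
    π≡ = proj₁ (IsPerm⇒split p)
    unique : Unique (before1 π ++ 1 ∷ after1 π)
    unique = subst Unique π≡ (IsPerm⇒Unique p)

  leftPart-IsPerm : IsPerm (length (before1 π ++ [ 1 ])) (leftPart π)
  leftPart-IsPerm = std-IsPerm (before1 π ++ [ 1 ])
    (Unique-++⁻ˡ (before1 π ++ [ 1 ]) (subst Unique (sym (++-assoc (before1 π) [ 1 ] (after1 π))) unique))

  rightPart-IsPerm : IsPerm (length (1 ∷ after1 π)) (rightPart π)
  rightPart-IsPerm = std-IsPerm (1 ∷ after1 π) (Unique-++⁻ʳ (before1 π) unique)

module _ (c : ℕ) where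

  record SplitEquiv (π σ : List ℕ) : Set where
    field
      before↭ : before1 π ↭ before1 σ
      after↭  : after1 π ↭ after1 σ
      left≈   : Equiv c (length (before1 π ++ [ 1 ])) (leftPart π) (leftPart σ)
      right≈  : Equiv c (length (1 ∷ after1 π)) (rightPart π) (rightPart σ)

  SplitEquiv-intro : ∀ {π α' β'} → 1 ∉ α' → before1 π ↭ α' → after1 π ↭ β' →
                     Equiv c (length (before1 π ++ [ 1 ])) (leftPart π) (std (α' ++ [ 1 ])) →
                     Equiv c (length (1 ∷ after1 π)) (rightPart π) (std (1 ∷ β')) →
                     SplitEquiv π (α' ++ 1 ∷ β')
  SplitEquiv-intro {π} {α'} {β'} 1∉ before↭ after↭ left≈ right≈ = record
    { before↭ = subst (before1 π ↭_) (sym before≡) before↭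
    ; after↭  = subst (after1 π ↭_) (sym after≡) after↭
    ; left≈   = subst (λ α → Equiv c _ (leftPart π) (std (α ++ [ 1 ]))) (sym before≡) left≈
    ; right≈  = subst (λ β → Equiv c _ (rightPart π) (std (1 ∷ β))) (sym after≡) right≈
    }
    where
    before≡ = proj₁ (before1-after1-++ α' β' 1∉)
    after≡ = proj₂ (before1-after1-++ α' β' 1∉)

  Move⇒SplitEquiv : ∀ {N π σ} → IsPerm (suc N) π → Move c (suc N) π σ → SplitEquiv π σ
  Move⇒SplitEquiv {π = π} pπ mv with IsPerm⇒split pπ
  ... | π≡ , 1∉ =
    split (LocalMove⇒MoveBeside1 c (before1 π) (after1 π) (IsPerm⇒Unique pπ) (IsPerm⇒Positive pπ) π≡ 1∉
             (proj₁ (Move⇒LocalMove c mv)))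
    where
    split : ∀ {σ} → MoveBeside1 c (before1 π) (after1 π) σ → SplitEquiv π σ
    split (left 1∉α' lmv) =
      SplitEquiv-intro 1∉α' (↭-cancelʳ [ 1 ] (LocalMove-↭ c lmv)) ↭-refl
        (fwd (LocalMove⇒Move c (LocalMove-std c lmv) (leftPart-IsPerm pπ)) ◅ ε) ε
    split (right lmv) =
      SplitEquiv-intro 1∉ ↭-refl (drop-∷ (LocalMove-↭ c lmv))
        ε (fwd (LocalMove⇒Move c (LocalMove-std c lmv) (rightPart-IsPerm pπ)) ◅ ε)

  SplitEquiv-refl : ∀ π → SplitEquiv π π
  SplitEquiv-refl π = record { before↭ = ↭-refl ; after↭ = ↭-refl ; left≈ = ε ; right≈ = ε }

  SplitEquiv-sym : ∀ {π σ} → SplitEquiv π σ → SplitEquiv σ π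
  SplitEquiv-sym {π} {σ} e = record
    { before↭ = ↭-sym before↭
    ; after↭  = ↭-sym after↭
    ; left≈   = subst (λ n → Equiv c n (leftPart σ) (leftPart π)) (↭-length (++⁺ʳ [ 1 ] before↭))
                  (EqClosure.symmetric (Move c _) left≈)
    ; right≈  = subst (λ n → Equiv c n (rightPart σ) (rightPart π)) (↭-length (↭-prep 1 after↭))
                  (EqClosure.symmetric (Move c _) right≈)
    }
    where open SplitEquiv e

  SplitEquiv-trans : ∀ {π σ ρ} → SplitEquiv π σ → SplitEquiv σ ρ → SplitEquiv π ρ
  SplitEquiv-trans {π} {σ} {ρ} e e' = record
    { before↭ = ↭-trans (before↭ e) (before↭ e')
    ; after↭  = ↭-trans (after↭ e) (after↭ e')
    ; left≈   = left≈ e ◅◅ subst (λ n → Equiv c n (leftPart σ) (leftPart ρ)) (sym (↭-length (++⁺ʳ [ 1 ] (before↭ e)))) (left≈ e')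
    ; right≈  = right≈ e ◅◅ subst (λ n → Equiv c n (rightPart σ) (rightPart ρ)) (sym (↭-length (↭-prep 1 (after↭ e)))) (right≈ e')
    }
    where open SplitEquiv

  Equiv⇒SplitEquiv : ∀ {N π σ} → IsPerm (suc N) π → Equiv c (suc N) π σ → SplitEquiv π σ
  Equiv⇒SplitEquiv {π = π} _ ε = SplitEquiv-refl π
  Equiv⇒SplitEquiv pπ (fwd mv ◅ rest) =
    SplitEquiv-trans (Move⇒SplitEquiv pπ mv) (Equiv⇒SplitEquiv (proj₂ (proj₂ (Move⇒LocalMove c mv))) rest)
  Equiv⇒SplitEquiv _ (bwd mv ◅ rest) with Move⇒LocalMove c mv
  ... | _ , pσ , _ = SplitEquiv-trans (SplitEquiv-sym (Move⇒SplitEquiv pσ mv)) (Equiv⇒SplitEquiv pσ rest)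

  SplitEquiv-BeginsWith1 : ∀ {N τ τ'} → IsPerm (suc N) τ' → SplitEquiv τ τ' → BeginsWith1 τ → BeginsWith1 τ'
  SplitEquiv-BeginsWith1 {τ = 1 ∷ τ} {τ'} p e refl with ↭-empty-inv (↭-sym (SplitEquiv.before↭ e))
  ... | before≡[] = subst BeginsWith1 (sym (trans (proj₁ (IsPerm⇒split p)) (cong (_++ 1 ∷ after1 τ') before≡[]))) refl

-- Gluing

-- The increasing bijection from 1, …, length S onto an increasing list S; it undoes std.
relabel : List ℕ → ℕ → ℕ
relabel S i = nth S (i ∸ 1)

relabel-strictlyMonotone : ∀ S → AllPairs _<_ S → ∀ {ρ} → IsPerm (length S) ρ → StrictlyMonotoneOn ρ (relabel S)
relabel-strictlyMonotone S inc p {x} {y} x∈ y∈ x<y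
  with ∈-range⁻ 1 (length S) (IsPerm-∈⇒∈range p x∈) | ∈-range⁻ 1 (length S) (IsPerm-∈⇒∈range p y∈)
relabel-strictlyMonotone S inc p {suc x} {suc y} _ _ (s≤s x<y) | _ | _ , s≤s y< = nth-increasing S inc x<y y<

map-relabel-↭ : ∀ S {ρ} → IsPerm (length S) ρ → map (relabel S) ρ ↭ S
map-relabel-↭ S p =
  ↭-trans (map⁺ (relabel S) p) (↭-reflexive (trans (cong (map (relabel S)) (map-suc-upTo (length S))) (map-nth-range S 1)))

relabel-std : ∀ w S → AllPairs _<_ S → w ↭ S → map (relabel S) (std w) ≡ w
relabel-std w S inc w↭S = trans (sym (map-∘ w)) (trans (map-cong-local (All.tabulate relabel-rank)) (map-id w))
  where
  relabel-rank : ∀ {x} → x ∈ w → relabel S (rank w x) ≡ x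
  relabel-rank {x} x∈ = trans (cong (nth S) (countBelow-↭ w↭S x)) (nth-countBelow S inc (∈-resp-↭ w↭S x∈))

module Gluing (n' : ℕ) where

  others : List ℕ
  others = range 2 n'

  -- T lists, in increasing order, the letters of others that it contains
  IsSelection : List ℕ → Set
  IsSelection T = filter (_∈? T) others ≡ T

  complement : List ℕ → List ℕ
  complement T = filter (∁? (_∈? T)) others

  -- ρ ends and τ begins with 1; the two copies of 1 are merged
  glue : List ℕ → List ℕ → List ℕ → List ℕ
  glue T ρ τ = map (relabel (1 ∷ T)) ρ ++ drop 1 (map (relabel (1 ∷ complement T)) τ)

  others-increasing : AllPairs _<_ others
  others-increasing = range-increasing 2 n'

  ∈-others⇒2≤ : ∀ {x} → x ∈ others → 2 ≤ x
  ∈-others⇒2≤ x∈ = proj₁ (∈-range⁻ 2 n' x∈)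

  IsSelection-⊆ : ∀ {T} → IsSelection T → ∀ {x} → x ∈ T → x ∈ others
  IsSelection-⊆ {T} sel {x} x∈ = proj₁ (∈-filter⁻ (_∈? T) {xs = others} (subst (x ∈_) (sym sel) x∈))

  1∷-increasing : ∀ {T} → AllPairs _<_ T → (∀ {x} → x ∈ T → x ∈ others) → AllPairs _<_ (1 ∷ T)
  1∷-increasing inc T⊆ = All.tabulate (λ x∈ → ∈-others⇒2≤ (T⊆ x∈)) ∷ inc

  1∷selection-increasing : ∀ {T} → IsSelection T → AllPairs _<_ (1 ∷ T)
  1∷selection-increasing {T} sel = 1∷-increasing (subst (AllPairs _<_) sel (AllPairsₚ.filter⁺ (_∈? T) others-increasing)) (IsSelection-⊆ sel)

  1∷complement-increasing : ∀ T → AllPairs _<_ (1 ∷ complement T)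
  1∷complement-increasing T =
    1∷-increasing (AllPairsₚ.filter⁺ (∁? (_∈? T)) others-increasing) (λ x∈ → proj₁ (∈-filter⁻ (∁? (_∈? T)) {xs = others} x∈))

  selection++complement↭others : ∀ {T} → IsSelection T → T ++ complement T ↭ others
  selection++complement↭others {T} sel = subst (λ S → S ++ complement T ↭ others) sel (filter-++-filter-∁-↭ (_∈? T) others)

  glue-IsPerm : ∀ T {ρ τ} → IsSelection T → IsPerm (length (1 ∷ T)) ρ → IsPerm (length (1 ∷ complement T)) τ →
                BeginsWith1 τ → IsPerm (suc n') (glue T ρ τ)
  glue-IsPerm T {ρ} {1 ∷ τ} sel pρ pτ refl =
    ↭-trans (++⁺ʳ _ (map-relabel-↭ (1 ∷ T) pρ))
      (↭-trans (↭-prep 1 (↭-trans (++⁺ˡ T (drop-∷ (map-relabel-↭ (1 ∷ complement T) pτ))) (selection++complement↭others sel)))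
               (↭-reflexive (sym (map-suc-upTo (suc n')))))

  glue-split : ∀ T {ρ τ} → IsSelection T → IsPerm (length (1 ∷ T)) ρ → EndsWith1 ρ →
               IsPerm (length (1 ∷ complement T)) τ → BeginsWith1 τ →
               before1 (glue T ρ τ) ↭ T × after1 (glue T ρ τ) ↭ complement T ×
               leftPart (glue T ρ τ) ≡ ρ × rightPart (glue T ρ τ) ≡ τ
  glue-split T {ρ} {1 ∷ τ₀} sel pρ ends pτ refl with last≡just⇒∷ʳ ρ ends
  ... | ρ₀ , refl = subst (_↭ T) before≡ A↭T , subst (_↭ complement T) after≡ B↭Tᶜ , leftPart≡ , rightPart≡
    where
    open ≡-Reasoning
    A B : List ℕ
    A = map (relabel (1 ∷ T)) ρ₀
    B = map (relabel (1 ∷ complement T)) τ₀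
    shape : glue T (ρ₀ ++ [ 1 ]) (1 ∷ τ₀) ≡ A ++ 1 ∷ B
    shape = trans (cong (_++ B) (map-++ (relabel (1 ∷ T)) ρ₀ [ 1 ])) (++-assoc A [ 1 ] B)
    A↭T : A ↭ T
    A↭T = ↭-cancelʳ [ 1 ] (↭-trans (↭-reflexive (sym (map-++ (relabel (1 ∷ T)) ρ₀ [ 1 ])))
                              (↭-trans (map-relabel-↭ (1 ∷ T) pρ) (∷↭∷ʳ 1 T)))
    B↭Tᶜ : B ↭ complement T
    B↭Tᶜ = drop-∷ (map-relabel-↭ (1 ∷ complement T) pτ)
    1∉A : 1 ∉ A
    1∉A 1∈ = <-irrefl refl (∈-others⇒2≤ (IsSelection-⊆ sel (∈-resp-↭ A↭T 1∈)))
    split≡ : before1 (A ++ 1 ∷ B) ≡ A × after1 (A ++ 1 ∷ B) ≡ B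
    split≡ = before1-after1-++ A B 1∉A
    before≡ : A ≡ before1 (glue T (ρ₀ ++ [ 1 ]) (1 ∷ τ₀))
    before≡ = sym (trans (cong before1 shape) (proj₁ split≡))
    after≡ : B ≡ after1 (glue T (ρ₀ ++ [ 1 ]) (1 ∷ τ₀))
    after≡ = sym (trans (cong after1 shape) (proj₂ split≡))
    leftPart≡ : leftPart (glue T (ρ₀ ++ [ 1 ]) (1 ∷ τ₀)) ≡ ρ₀ ++ [ 1 ]
    leftPart≡ = begin
      std (before1 (glue T (ρ₀ ++ [ 1 ]) (1 ∷ τ₀)) ++ [ 1 ]) ≡⟨ cong (λ α → std (α ++ [ 1 ])) (sym before≡) ⟩
      std (A ++ [ 1 ])                                       ≡⟨ cong std (sym (map-++ (relabel (1 ∷ T)) ρ₀ [ 1 ])) ⟩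
      std (map (relabel (1 ∷ T)) (ρ₀ ++ [ 1 ]))              ≡⟨ std-map (relabel-strictlyMonotone (1 ∷ T) (1∷selection-increasing sel) pρ) (ρ₀ ++ [ 1 ]) (λ x∈ → x∈) ⟩
      std (ρ₀ ++ [ 1 ])                                      ≡⟨ std-IsPerm≡id _ _ pρ ⟩
      ρ₀ ++ [ 1 ]                                            ∎
    rightPart≡ : rightPart (glue T (ρ₀ ++ [ 1 ]) (1 ∷ τ₀)) ≡ 1 ∷ τ₀
    rightPart≡ = begin
      std (1 ∷ after1 (glue T (ρ₀ ++ [ 1 ]) (1 ∷ τ₀)))       ≡⟨ cong (λ β → std (1 ∷ β)) (sym after≡) ⟩
      std (map (relabel (1 ∷ complement T)) (1 ∷ τ₀))       ≡⟨ std-map (relabel-strictlyMonotone (1 ∷ complement T) (1∷complement-increasing T) pτ) (1 ∷ τ₀) (λ x∈ → x∈) ⟩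
      std (1 ∷ τ₀)                                          ≡⟨ std-IsPerm≡id _ _ pτ ⟩
      1 ∷ τ₀                                                ∎

  IsSelection-↭⇒≡ : ∀ {T T'} → IsSelection T → IsSelection T' → T ↭ T' → T ≡ T'
  IsSelection-↭⇒≡ {T} {T'} sel sel' T↭T' =
    trans (sym sel) (trans (filter-cong-local (_∈? T) (_∈? T') others (λ _ → ∈-resp-↭ T↭T' , ∈-resp-↭ (↭-sym T↭T'))) sel')

  length-1∷complement : ∀ {T} → IsSelection T → length (1 ∷ complement T) ≡ n' ∸ length T + 1
  length-1∷complement {T} sel = trans (+-comm 1 (length (complement T))) (cong (_+ 1) (sym (begin
    n' ∸ length T                                ≡⟨ cong (_∸ length T) (sym |others|) ⟩
    length (T ++ complement T) ∸ length T        ≡⟨ cong (_∸ length T) (length-++ T) ⟩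
    length T + length (complement T) ∸ length T  ≡⟨ m+n∸m≡n (length T) (length (complement T)) ⟩
    length (complement T)                        ∎)))
    where
    open ≡-Reasoning
    |others| : length (T ++ complement T) ≡ n'
    |others| = trans (↭-length (selection++complement↭others sel)) (length-range 2 n')

  module _ (c : ℕ) where

    glue-LocalMove-left : ∀ T {ρ ρ₁ τ} → IsSelection T → IsPerm (length (1 ∷ T)) ρ →
                          LocalMove c ρ ρ₁ → LocalMove c (glue T ρ τ) (glue T ρ₁ τ)
    glue-LocalMove-left T sel pρ lmv =
      LocalMove-++ʳ c _ (LocalMove-map c (relabel (1 ∷ T)) (relabel-strictlyMonotone (1 ∷ T) (1∷selection-increasing sel) pρ) lmv)

    glue-LocalMove-right : ∀ T {ρ τ τ₁} → IsPerm (length (1 ∷ complement T)) τ → EndsWith1 ρ →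
                           BeginsWith1 τ → BeginsWith1 τ₁ → LocalMove c τ τ₁ → LocalMove c (glue T ρ τ) (glue T ρ τ₁)
    glue-LocalMove-right T {ρ} {1 ∷ τ₀} {1 ∷ τ₁} pτ ends refl refl lmv with last≡just⇒∷ʳ ρ ends
    ... | ρ₀ , refl =
      subst₂ (LocalMove c) (sym (shape τ₀)) (sym (shape τ₁))
        (LocalMove-++ˡ c (map (relabel (1 ∷ T)) ρ₀)
          (LocalMove-map c (relabel (1 ∷ complement T)) (relabel-strictlyMonotone (1 ∷ complement T) (1∷complement-increasing T) pτ) lmv))
      where
      shape : ∀ τ' → glue T (ρ₀ ++ [ 1 ]) (1 ∷ τ') ≡ map (relabel (1 ∷ T)) ρ₀ ++ 1 ∷ map (relabel (1 ∷ complement T)) τ'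
      shape τ' = trans (cong (_++ _) (map-++ (relabel (1 ∷ T)) ρ₀ [ 1 ])) (++-assoc (map (relabel (1 ∷ T)) ρ₀) [ 1 ] _)

    glue-cong-left : ∀ T {ρ ρ' τ} → IsSelection T → IsPerm (length (1 ∷ T)) ρ →
                     IsPerm (length (1 ∷ complement T)) τ → BeginsWith1 τ →
                     Equiv c (length (1 ∷ T)) ρ ρ' → Equiv c (suc n') (glue T ρ τ) (glue T ρ' τ)
    glue-cong-left T sel pρ pτ begins ε = ε
    glue-cong-left T {τ = τ} sel pρ pτ begins (fwd mv ◅ rest) with Move⇒LocalMove c mv
    ... | lmv , _ , pρ₁ =
      fwd (LocalMove⇒Move c (glue-LocalMove-left T {τ = τ} sel pρ lmv) (glue-IsPerm T sel pρ pτ begins))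
      ◅ glue-cong-left T sel pρ₁ pτ begins rest
    glue-cong-left T {τ = τ} sel pρ pτ begins (bwd mv ◅ rest) with Move⇒LocalMove c mv
    ... | lmv , pρ₁ , _ =
      bwd (LocalMove⇒Move c (glue-LocalMove-left T {τ = τ} sel pρ₁ lmv) (glue-IsPerm T sel pρ₁ pτ begins))
      ◅ glue-cong-left T sel pρ₁ pτ begins rest

    glue-cong-right : ∀ T {ρ τ τ'} → IsSelection T → IsPerm (length (1 ∷ T)) ρ → EndsWith1 ρ →
                      IsPerm (length (1 ∷ complement T)) τ → BeginsWith1 τ →
                      Equiv c (length (1 ∷ complement T)) τ τ' → Equiv c (suc n') (glue T ρ τ) (glue T ρ τ')
    glue-cong-right T sel pρ ends pτ begins ε = ε
    glue-cong-right T sel pρ ends pτ begins (fwd mv ◅ rest) with Move⇒LocalMove c mv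
    ... | lmv , _ , pτ₁ =
      fwd (LocalMove⇒Move c (glue-LocalMove-right T pτ ends begins begins₁ lmv) (glue-IsPerm T sel pρ pτ begins))
      ◅ glue-cong-right T sel pρ ends pτ₁ begins₁ rest
      where begins₁ = SplitEquiv-BeginsWith1 c pτ₁ (Move⇒SplitEquiv c pτ mv) begins
    glue-cong-right T sel pρ ends pτ begins (bwd mv ◅ rest) with Move⇒LocalMove c mv
    ... | lmv , pτ₁ , _ =
      bwd (LocalMove⇒Move c (glue-LocalMove-right T pτ₁ ends begins₁ begins lmv) (glue-IsPerm T sel pρ pτ₁ begins₁))
      ◅ glue-cong-right T sel pρ ends pτ₁ begins₁ rest
      where begins₁ = SplitEquiv-BeginsWith1 c pτ₁ (SplitEquiv-sym c (Move⇒SplitEquiv c pτ₁ mv)) begins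

  selection : List ℕ → List ℕ
  selection π = filter (_∈? before1 π) others

  module Parts {π} (p : IsPerm (suc n') π) where

    private
      α β : List ℕ
      α = before1 π
      β = after1 π
      π≡ : π ≡ α ++ 1 ∷ β
      π≡ = proj₁ (IsPerm⇒split p)
      unique : Unique (α ++ 1 ∷ β)
      unique = subst Unique π≡ (IsPerm⇒Unique p)
      α++β↭others : α ++ β ↭ others
      α++β↭others = drop-mid α [] (↭-trans (↭-reflexive (sym π≡)) (↭-trans p (↭-reflexive (map-suc-upTo (suc n')))))
      α⊆others : ∀ {x} → x ∈ α → x ∈ others
      α⊆others x∈ = ∈-resp-↭ α++β↭others (∈-++⁺ˡ x∈)
      positive : Positive (α ++ 1 ∷ β)
      positive x∈ = IsPerm⇒Positive p (subst (_ ∈_) (sym π≡) x∈)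

    selection-IsSelection : IsSelection (selection π)
    selection-IsSelection = filter-cong-local (_∈? selection π) (_∈? α) others
      (λ x∈ → (λ x∈sel → proj₂ (∈-filter⁻ (_∈? α) {xs = others} x∈sel)) , ∈-filter⁺ (_∈? α) x∈)

    before1↭selection : α ↭ selection π
    before1↭selection = Unique-sameElements⇒↭ (Unique-++⁻ˡ α unique) (Uniqueₚ.filter⁺ (_∈? α) (increasing⇒Unique others-increasing))
      (λ x∈ → ∈-filter⁺ (_∈? α) (α⊆others x∈) x∈) (λ x∈ → proj₂ (∈-filter⁻ (_∈? α) {xs = others} x∈))

    after1↭complement : β ↭ complement (selection π)
    after1↭complement = ↭-cancelˡ (selection π)
      (↭-trans (++⁺ʳ β (↭-sym before1↭selection)) (↭-trans α++β↭others (↭-sym (selection++complement↭others selection-IsSelection))))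

    leftPart-IsPerm-selection : IsPerm (length (1 ∷ selection π)) (leftPart π)
    leftPart-IsPerm-selection = subst (λ n → IsPerm n (leftPart π)) (↭-length (↭-trans (↭-sym (∷↭∷ʳ 1 α)) (↭-prep 1 before1↭selection)))
                         (leftPart-IsPerm p)

    rightPart-IsPerm-complement : IsPerm (length (1 ∷ complement (selection π))) (rightPart π)
    rightPart-IsPerm-complement = subst (λ n → IsPerm n (rightPart π)) (↭-length (↭-prep 1 after1↭complement)) (rightPart-IsPerm p)

    leftPart-EndsWith1 : EndsWith1 (leftPart π)
    leftPart-EndsWith1 = trans (last-map (rank (α ++ [ 1 ])) (α ++ [ 1 ]))
      (trans (cong (Maybe.map (rank (α ++ [ 1 ]))) (last-∷ʳ α 1)) (cong just (rank-1 (α ++ [ 1 ]) (λ x∈ → positive (subst (_ ∈_) (++-assoc α [ 1 ] β) (∈-++⁺ˡ x∈))))))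

    rightPart-BeginsWith1 : BeginsWith1 (rightPart π)
    rightPart-BeginsWith1 = cong just (rank-1 (1 ∷ β) (λ x∈ → positive (∈-++⁺ʳ α x∈)))

    glue-parts : glue (selection π) (leftPart π) (rightPart π) ≡ π
    glue-parts = begin
      glue (selection π) (leftPart π) (rightPart π)
        ≡⟨ cong₂ _++_ (relabel-std (α ++ [ 1 ]) (1 ∷ selection π) (1∷selection-increasing selection-IsSelection)
                         (↭-trans (↭-sym (∷↭∷ʳ 1 α)) (↭-prep 1 before1↭selection)))
                      (cong (drop 1) (relabel-std (1 ∷ β) (1 ∷ complement (selection π)) (1∷complement-increasing (selection π))
                         (↭-prep 1 after1↭complement))) ⟩
      (α ++ [ 1 ]) ++ β ≡⟨ ++-assoc α [ 1 ] β ⟩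
      α ++ 1 ∷ β        ≡⟨ sym π≡ ⟩
      π                 ∎
      where open ≡-Reasoning

-- Counting the classes

module _ {P N h m} (classes : ClassesWith P N h m) where

  -- junk value [] off the labels
  representative : ℕ → List ℕ
  representative i with i ∈? proj₁ classes
  ... | yes i∈ = proj₁ (Equivalence.to (proj₁ (proj₂ (proj₂ classes)) i) i∈)
  ... | no _ = []

  representative-spec : ∀ {i} → i ∈ proj₁ classes → IsPerm N (representative i) × P (representative i) × h (representative i) ≡ i
  representative-spec {i} i∈ with i ∈? proj₁ classes
  ... | yes i∈' = proj₂ (Equivalence.to (proj₁ (proj₂ (proj₂ classes)) i) i∈')
  ... | no i∉ = ⊥-elim (i∉ i∈)

  label∈classes : ∀ {π} → IsPerm N π → P π → h π ∈ proj₁ classes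
  label∈classes {π} p Pπ = Equivalence.from (proj₁ (proj₂ (proj₂ classes)) (h π)) (π , p , Pπ , refl)

module Counting (c : ℕ) (k : ℕ → ℕ) (h : ℕ → List ℕ → ℕ) (g01 g10 : ℕ → ℕ)
                (counts : ∀ N → IsClassCount c N (k N) (h N))
                (endClasses : ∀ N → 1 ≤ N → ClassesWith EndsWith1 N (h N) (g01 N))
                (beginClasses : ∀ N → 1 ≤ N → ClassesWith BeginsWith1 N (h N) (g10 N))
                (n' : ℕ) where

  open Gluing n'

  n : ℕ
  n = suc n'

  -- sizes of the left and right parts when j letters precede the 1
  leftSize rightSize : ℕ → ℕ
  leftSize j = suc j
  rightSize j = n' ∸ j + 1

  ends : ∀ j → ClassesWith EndsWith1 (leftSize j) (h (leftSize j)) (g01 (leftSize j))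
  ends j = endClasses (leftSize j) (s≤s z≤n)

  begins : ∀ j → ClassesWith BeginsWith1 (rightSize j) (h (rightSize j)) (g10 (rightSize j))
  begins j = beginClasses (rightSize j) (subst (1 ≤_) (+-comm 1 (n' ∸ j)) (s≤s z≤n))

  -- a class of S_n is encoded by (j, T, a, b): the letters T before the 1 (j of them) and the labels a, b
  -- of the classes of its left and right parts
  Code : Set
  Code = ℕ × List ℕ × ℕ × ℕ

  codesWith : ℕ → List (List ℕ × ℕ × ℕ)
  codesWith j = dependentProduct (sublistsOfLength others j) λ _ → dependentProduct (proj₁ (ends j)) λ _ → proj₁ (begins j)

  codes : List Code
  codes = dependentProduct (upTo n) codesWith

  record IsCode (t : Code) : Set where
    constructor isCode
    field
      j<n : proj₁ t < n
      T∈ : proj₁ (proj₂ t) ∈ sublistsOfLength others (proj₁ t)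
      a∈ : proj₁ (proj₂ (proj₂ t)) ∈ proj₁ (ends (proj₁ t))
      b∈ : proj₂ (proj₂ (proj₂ t)) ∈ proj₁ (begins (proj₁ t))

  ∈-codes⁻ : ∀ {t} → t ∈ codes → IsCode t
  ∈-codes⁻ {j , T , a , b} t∈ with ∈-dependentProduct⁻ (upTo n) _ t∈
  ... | j∈ , rest∈ with ∈-dependentProduct⁻ (sublistsOfLength others j) _ rest∈
  ...   | T∈ , ab∈ with ∈-dependentProduct⁻ (proj₁ (ends j)) _ ab∈
  ...     | a∈ , b∈ = isCode (∈-upTo⁻ j∈) T∈ a∈ b∈

  ∈-codes⁺ : ∀ {t} → IsCode t → t ∈ codes
  ∈-codes⁺ {j , T , a , b} (isCode j<n T∈ a∈ b∈) =
    ∈-dependentProduct⁺ _ (∈-upTo⁺ j<n) (∈-dependentProduct⁺ _ T∈ (∈-dependentProduct⁺ _ a∈ b∈))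

  Unique-codes : Unique codes
  Unique-codes =
    Unique-dependentProduct (upTo n) _ (Uniqueₚ.upTo⁺ n) λ j _ →
      Unique-dependentProduct _ _ (Unique-sublistsOfLength others j (increasing⇒Unique others-increasing)) λ _ _ →
        Unique-dependentProduct _ _ (proj₁ (proj₂ (ends j))) λ _ _ → proj₁ (proj₂ (begins j))

  glued : Code → List ℕ
  glued (j , T , a , b) = glue T (representative (ends j) a) (representative (begins j) b)

  codeLabel : Code → ℕ
  codeLabel t = h n (glued t)

  module ValidCode {j T a b} (v : IsCode (j , T , a , b)) where
    open IsCode v

    selection-facts : IsSelection T × length T ≡ j
    selection-facts = sublistsOfLength-sound others j (increasing⇒Unique others-increasing) T∈
    sel : IsSelection T
    sel = proj₁ selection-facts
    |T| : length T ≡ j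
    |T| = proj₂ selection-facts

    ρ τ : List ℕ
    ρ = representative (ends j) a
    τ = representative (begins j) b
    ρ-spec : IsPerm (leftSize j) ρ × EndsWith1 ρ × h (leftSize j) ρ ≡ a
    ρ-spec = representative-spec (ends j) a∈
    τ-spec : IsPerm (rightSize j) τ × BeginsWith1 τ × h (rightSize j) τ ≡ b
    τ-spec = representative-spec (begins j) b∈

    ρ-IsPerm : IsPerm (length (1 ∷ T)) ρ
    ρ-IsPerm = subst (λ N → IsPerm N ρ) (cong suc (sym |T|)) (proj₁ ρ-spec)
    τ-IsPerm : IsPerm (length (1 ∷ complement T)) τ
    τ-IsPerm = subst (λ N → IsPerm N τ) (sym (trans (length-1∷complement sel) (cong (λ l → n' ∸ l + 1) |T|))) (proj₁ τ-spec)

    glued-IsPerm : IsPerm n (glue T ρ τ)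
    glued-IsPerm = glue-IsPerm T sel ρ-IsPerm τ-IsPerm (proj₁ (proj₂ τ-spec))

    split : before1 (glue T ρ τ) ↭ T × after1 (glue T ρ τ) ↭ complement T ×
            leftPart (glue T ρ τ) ≡ ρ × rightPart (glue T ρ τ) ≡ τ
    split = glue-split T sel ρ-IsPerm (proj₁ (proj₂ ρ-spec)) τ-IsPerm (proj₁ (proj₂ τ-spec))

  codeLabel-< : ∀ {t} → t ∈ codes → codeLabel t < k n
  codeLabel-< {j , T , a , b} t∈ = IsClassCount.bounded (counts n) _ (ValidCode.glued-IsPerm (∈-codes⁻ t∈))

  module SameLabel {j T a b j' T' a' b'} (v : IsCode (j , T , a , b)) (v' : IsCode (j' , T' , a' , b'))
                   (eq : codeLabel (j , T , a , b) ≡ codeLabel (j' , T' , a' , b')) where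
    module V = ValidCode v
    module V' = ValidCode v'

    splitEquiv : SplitEquiv c (glued (j , T , a , b)) (glued (j' , T' , a' , b'))
    splitEquiv = Equiv⇒SplitEquiv c V.glued-IsPerm (IsClassCount.complete (counts n) _ _ V.glued-IsPerm V'.glued-IsPerm eq)

    same-T : T ≡ T'
    same-T = IsSelection-↭⇒≡ V.sel V'.sel (↭-trans (↭-sym (proj₁ V.split)) (↭-trans (SplitEquiv.before↭ splitEquiv) (proj₁ V'.split)))

    same-j : j ≡ j'
    same-j = trans (sym V.|T|) (trans (cong length same-T) V'.|T|)

    left≈ : Equiv c (leftSize j) V.ρ V'.ρ
    left≈ = subst (λ N → Equiv c N V.ρ V'.ρ) size
              (subst₂ (Equiv c _) (proj₁ (proj₂ (proj₂ V.split))) (proj₁ (proj₂ (proj₂ V'.split))) (SplitEquiv.left≈ splitEquiv))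
      where
      size : length (before1 (glued (j , T , a , b)) ++ [ 1 ]) ≡ leftSize j
      size = trans (↭-length (↭-trans (↭-sym (∷↭∷ʳ 1 _)) (↭-prep 1 (proj₁ V.split)))) (cong suc V.|T|)

    right≈ : Equiv c (rightSize j) V.τ V'.τ
    right≈ = subst (λ N → Equiv c N V.τ V'.τ) size
               (subst₂ (Equiv c _) (proj₂ (proj₂ (proj₂ V.split))) (proj₂ (proj₂ (proj₂ V'.split))) (SplitEquiv.right≈ splitEquiv))
      where
      size : length (1 ∷ after1 (glued (j , T , a , b))) ≡ rightSize j
      size = trans (↭-length (↭-prep 1 (proj₁ (proj₂ V.split))))
                   (trans (length-1∷complement V.sel) (cong (λ l → n' ∸ l + 1) V.|T|))

  same-code : ∀ {j T a b j' T' a' b'} (v : IsCode (j , T , a , b)) (v' : IsCode (j' , T' , a' , b')) →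
              j ≡ j' → T ≡ T' →
              Equiv c (leftSize j) (ValidCode.ρ v) (ValidCode.ρ v') → Equiv c (rightSize j) (ValidCode.τ v) (ValidCode.τ v') →
              (j , T , a , b) ≡ (j' , T' , a' , b')
  same-code {j} {T} v v' refl refl left≈ right≈ = cong₂ (λ x y → j , T , x , y)
    (trans (sym (proj₂ (proj₂ V.ρ-spec)))
      (trans (IsClassCount.sound (counts (leftSize j)) _ _ (proj₁ V.ρ-spec) (proj₁ V'.ρ-spec) left≈) (proj₂ (proj₂ V'.ρ-spec))))
    (trans (sym (proj₂ (proj₂ V.τ-spec)))
      (trans (IsClassCount.sound (counts (rightSize j)) _ _ (proj₁ V.τ-spec) (proj₁ V'.τ-spec) right≈) (proj₂ (proj₂ V'.τ-spec))))
    where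
    module V = ValidCode v
    module V' = ValidCode v'

  codeLabel-injective : ∀ {t t'} → t ∈ codes → t' ∈ codes → codeLabel t ≡ codeLabel t' → t ≡ t'
  codeLabel-injective {j , T , a , b} {j' , T' , a' , b'} t∈ t'∈ eq =
    same-code (∈-codes⁻ t∈) (∈-codes⁻ t'∈) same-j same-T left≈ right≈
    where open SameLabel (∈-codes⁻ t∈) (∈-codes⁻ t'∈) eq

  codeOf : List ℕ → Code
  codeOf π = j , selection π , h (leftSize j) (leftPart π) , h (rightSize j) (rightPart π)
    where j = length (selection π)

  module _ {π} (p : IsPerm n π) where
    open Parts p
    private
      T = selection π
      j = length T
      rightPart-IsPerm-rightSize : IsPerm (rightSize j) (rightPart π)
      rightPart-IsPerm-rightSize = subst (λ N → IsPerm N (rightPart π)) (length-1∷complement selection-IsSelection) rightPart-IsPerm-complement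

    codeOf-IsCode : IsCode (codeOf π)
    codeOf-IsCode = isCode (s≤s (subst (j ≤_) (length-range 2 n') (length-filter (_∈? before1 π) others)))
      (filter∈sublistsOfLength (_∈? before1 π) others)
      (label∈classes (ends j) leftPart-IsPerm-selection leftPart-EndsWith1)
      (label∈classes (begins j) rightPart-IsPerm-rightSize rightPart-BeginsWith1)

    codeLabel-codeOf : codeLabel (codeOf π) ≡ h n π
    codeLabel-codeOf = IsClassCount.sound (counts n) _ _ V.glued-IsPerm p
      (subst (Equiv c n (glued (codeOf π))) glue-parts
        (glue-cong-left c T V.sel V.ρ-IsPerm V.τ-IsPerm (proj₁ (proj₂ V.τ-spec)) ρ≈
         ◅◅ glue-cong-right c T selection-IsSelection leftPart-IsPerm-selection leftPart-EndsWith1 V.τ-IsPerm (proj₁ (proj₂ V.τ-spec)) τ≈))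
      where
      module V = ValidCode codeOf-IsCode
      ρ≈ : Equiv c (length (1 ∷ T)) V.ρ (leftPart π)
      ρ≈ = IsClassCount.complete (counts (leftSize j)) _ _ (proj₁ V.ρ-spec) leftPart-IsPerm-selection (proj₂ (proj₂ V.ρ-spec))
      τ≈ : Equiv c (length (1 ∷ complement T)) V.τ (rightPart π)
      τ≈ = subst (λ N → Equiv c N V.τ (rightPart π)) (sym (length-1∷complement selection-IsSelection))
             (IsClassCount.complete (counts (rightSize j)) _ _ (proj₁ V.τ-spec) rightPart-IsPerm-rightSize (proj₂ (proj₂ V.τ-spec)))

  codeLabel-onto : ∀ {i} → i < k n → i ∈ map codeLabel codes
  codeLabel-onto i< with IsClassCount.onto (counts n) _ i<
  ... | π , p , refl = subst (_∈ map codeLabel codes) (codeLabel-codeOf p) (∈-map⁺ codeLabel (∈-codes⁺ (codeOf-IsCode p)))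

  length-codes≡classCount : length codes ≡ k n
  length-codes≡classCount = trans (sym (length-map codeLabel codes))
    (length-Unique-upTo (map codeLabel codes) (k n)
      (Unique-map-injectiveOn codeLabel codes (λ _ _ → codeLabel-injective) Unique-codes)
      bounded codeLabel-onto)
    where
    bounded : ∀ {i} → i ∈ map codeLabel codes → i < k n
    bounded i∈ with ∈-map⁻ codeLabel i∈
    ... | t , t∈ , refl = codeLabel-< t∈

  length-codes : length codes ≡ sumFrom1 n (λ j → g01 j * g10 (n ∸ j + 1) * ((n ∸ 1) C (j ∸ 1)))
  length-codes = trans (length-dependentProduct (upTo n) codesWith) (cong sum (map-cong-local (All.tabulate length-codesWith)))
    where
    length-codesWith : ∀ {j} → j ∈ upTo n → length (codesWith j) ≡ g01 (suc j) * g10 (rightSize j) * (n' C j)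
    length-codesWith {j} _ = begin
      length (codesWith j)
        ≡⟨ length-dependentProduct-const (sublistsOfLength others j) _ _ (λ _ _ →
             length-dependentProduct-const (proj₁ (ends j)) (λ _ → proj₁ (begins j)) _ (λ _ _ → proj₂ (proj₂ (proj₂ (begins j))))) ⟩
      length (sublistsOfLength others j) * (length (proj₁ (ends j)) * g10 (rightSize j))
        ≡⟨ cong₂ _*_ (trans (length-sublistsOfLength others j) (cong (_C j) (length-range 2 n')))
                     (cong (_* g10 (rightSize j)) (proj₂ (proj₂ (proj₂ (ends j))))) ⟩
      (n' C j) * (g01 (suc j) * g10 (rightSize j))
        ≡⟨ *-comm (n' C j) _ ⟩
      g01 (suc j) * g10 (rightSize j) * (n' C j) ∎
      where open ≡-Reasoning

module _ (c : ℕ) where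

  Move-length : ∀ {N x y} → Move c N x y → suc c ≤ N
  Move-length {N} (move a u v b |u| _ px _ _) = subst (suc c ≤_) |π| (subst (_≤ length (a ++ u ++ b)) |u| u≤π)
    where
    |π| : length (a ++ u ++ b) ≡ N
    |π| = trans (↭-length px) (length-1…N N)
    u≤π : length u ≤ length (a ++ u ++ b)
    u≤π = subst (length u ≤_) (sym (trans (length-++ a) (cong (length a +_) (length-++ u))))
            (≤-trans (m≤m+n (length u) (length b)) (m≤n+m _ (length a)))

  Equiv⇒≡ : ∀ {N x y} → N < suc c → Equiv c N x y → x ≡ y
  Equiv⇒≡ N< ε = refl
  Equiv⇒≡ N< (fwd mv ◅ _) with () ← <-irrefl refl (<-≤-trans N< (Move-length mv))
  Equiv⇒≡ N< (bwd mv ◅ _) with () ← <-irrefl refl (<-≤-trans N< (Move-length mv))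

  classCount-small : ∀ N {K H} → N < suc c → IsClassCount c N K H → K ≡ N !
  classCount-small N {K} {H} N< cc = begin
    K                                 ≡⟨ sym (length-Unique-upTo (map H (permutations N)) K unique bounded' onto') ⟩
    length (map H (permutations N))   ≡⟨ length-map H (permutations N) ⟩
    length (permutations N)           ≡⟨ length-permutationsOf N _ (length-1…N N) ⟩
    N !                               ∎
    where
    open IsClassCount cc
    open Relation.Binary.PropositionalEquality.≡-Reasoning
    unique : Unique (map H (permutations N))
    unique = Unique-map-injectiveOn H (permutations N)
               (λ x y x∈ y∈ eq → Equiv⇒≡ N< (complete x y (permutations-sound N x∈) (permutations-sound N y∈) eq))
               (Unique-permutationsOf N _ (Unique-1…N N))
    bounded' : ∀ {i} → i ∈ map H (permutations N) → i < K
    bounded' i∈ with ∈-map⁻ H i∈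
    ... | π , π∈ , refl = bounded π (permutations-sound N π∈)
    onto' : ∀ {i} → i < K → i ∈ map H (permutations N)
    onto' i< with onto _ i<
    ... | π , p , refl = ∈-map⁺ H (permutations-complete N p)

mainTheorem15 : (c : ℕ) → 1 ≤ c →
    ((N : ℕ) → Σ ℕ λ k → Σ (List ℕ → ℕ) λ h → IsClassCount c N k h)
    × ((N k : ℕ) (h : List ℕ → ℕ) → IsClassCount c N k h →
         (∃ λ m → ClassesWith EndsWith1 N h m) × (∃ λ m → ClassesWith BeginsWith1 N h m))
    × ((k : ℕ → ℕ) (h : ℕ → List ℕ → ℕ) (g01 g10 : ℕ → ℕ) →
         ((N : ℕ) → IsClassCount c N (k N) (h N)) →
         ((N : ℕ) → 1 ≤ N → ClassesWith EndsWith1 N (h N) (g01 N)) →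
         ((N : ℕ) → 1 ≤ N → ClassesWith BeginsWith1 N (h N) (g10 N)) →
         (n : ℕ) → 1 ≤ n →
           (n < suc c → k n ≡ n !)
           × (suc c ≤ n →
               k n ≡ sumFrom1 n (λ j → g01 j * g10 (n ∸ j + 1) * ((n ∸ 1) C (j ∸ 1)))))
mainTheorem15 c _ =
  classCount c ,
  (λ N k h cc → classesWith c EndsWith1 EndsWith1? N k h cc , classesWith c BeginsWith1 BeginsWith1? N k h cc) ,
  λ { k h g01 g10 counts ends begins (suc n') _ →
        (λ n< → classCount-small c (suc n') n< (counts (suc n'))) ,
        (λ _ → let open Counting c k h g01 g10 counts ends begins n' in trans (sym length-codes≡classCount) length-codes) }
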